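{- Let $\mathbf{g}\in E$ and $\tau,\sigma\in\mathcal{U}_{\mathbf{g},\mathbf{g}}$ with $p\nmid k_\tau k_\sigma$. Then $D_{\mathbf{g},\mathbf{g},\tau}D_{\mathbf{g},\mathbf{g},\sigma}=\delta_{\tau,\sigma}D_{\mathbf{g},\mathbf{g},\tau}$, where $\delta_{\tau,\sigma}\in\{\overline0,\overline1\}$ is the Kronecker delta.
   Context: Let $\mathbb{F}$ be a field of characteristic $p$ ($p=0$ or a prime). For an integer $a$ let $\overline{a}$ be its image in $\mathbb{F}$; write $p\mid a$ if $\overline a=0$ and $p\nmid a$ otherwise. Fix $n\ge1$ and integers $\ell_1,\dots,\ell_n,m_1,\dots,m_n\ge2$. For each $i\in\{1,\dots,n\}$ let $U_i$ be a set with $|U_i|=\ell_im_i$ partitioned into $\ell_i$ blocks of size $m_i$, with relations $R^i_0=\{(a,a)\}$, $R^i_1=\{(a,b):a\ne b\text{ in the same block}\}$, $R^i_2=\{(a,b):a,b\text{ in different blocks}\}$. Let $X=\prod_iU_i$, $E$ the set of $n$-tuples with entries in $\{0,1,2\}$, $R_{\mathbf{g}}=\{(\mathbf{a},\mathbf{b}):(\mathbf{a}_i,\mathbf{b}_i)\in R^i_{\mathbf{g}_i}\ \forall i\}$. For $\mathbf{g}\in E$, $j\in\{0,1,2\}$ put $S_j(\mathbf{g})=\{a:\mathbf{g}_a=j\}$; for $V\subseteq\{1,\dots,n\}$ put $V^\bullet=\{a\in V:\ell_a>2\}$, $V^\circ=\{a\in V:m_a>2\}$. Fix $\mathbf{x}\in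 X$; $A_{\mathbf{g}}\in\mathrm{M}_X(\mathbb{F})$ is the $0/1$ adjacency matrix of $R_{\mathbf{g}}$, $E^*_{\mathbf{g}}$ the diagonal matrix with $(\mathbf{y},\mathbf{y})$-entry $\overline1$ iff $(\mathbf{x},\mathbf{y})\in R_{\mathbf{g}}$; $O$ is the zero matrix. For triples $\sigma=(U,V,W)$, $\sigma'$ of subsets: $\sigma\preceq\sigma'$ is componentwise inclusion, $|\sigma|=|U|+|V|+|W|$, $k_\sigma=\prod_{j\in U}(m_j-1)\prod_{j\in V}(\ell_j-1)m_j\prod_{j\in W\setminus V}m_j$ (empty products $=1$). For $\mathbf{g},\mathbf{h}\in E$, $\mathcal{U}_{\mathbf{g},\mathbf{h}}$ is the set of triples $(J_1,J_2,J_3)$ with $J_1\subseteq(S_1(\mathbf{g})\cap S_1(\mathbf{h}))^\circ$, $J_2\subseteq(S_2(\mathbf{g})\cap S_2(\mathbf{h}))^\bullet$, $J_2\subseteq J_3\subseteq S_2(\mathbf{g})\cap S_2(\mathbf{h})$. For $\tau=(J_1,J_2,J_3)\in\mathcal{U}_{\mathbf{g},\mathbf{h}}$, $B_{\mathbf{g},\mathbf{h},\tau}=\sum E^*_{\mathbf{g}}A_{\mathbf{a}}E^*_{\mathbf{h}}$ over all $\mathbf{a}\in E$ with $E^*_{\mathbf{g}}A_{\mathbf{a}}E^*_{\mathbf{h}}\ne O$, $S_1(\mathbf{a})\cap(S_1(\mathbf{g})\cap S_1(\mathbf{h}))^\circ\subseteq J_1$, $S_2(\mathbf{a})\cap(S_2(\mathbf{g})\cap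 S_2(\mathbf{h}))^\bullet\subseteq J_2$, $S_1(\mathbf{a})\cap S_2(\mathbf{g})\cap S_2(\mathbf{h})\subseteq J_3$. For $\tau=(J_1,J_2,J_3)\in\mathcal{U}_{\mathbf{g},\mathbf{g}}$ put $(\mathbf{g},\mathbf{g};\tau)=(S_1(\mathbf{g})^\circ,J_3^\bullet,S_2(\mathbf{g}))$, $n_{\mathbf{g},\mathbf{g},\tau}=|(\mathbf{g},\mathbf{g};\tau)|-|\tau|$, and for $t\in\{0,\dots,n_{\mathbf{g},\mathbf{g},\tau}\}$ let $\mathcal{U}_{\mathbf{g},\mathbf{g},\tau,t}$ be the set of triples $\alpha$ with $\tau\preceq\alpha\preceq(\mathbf{g},\mathbf{g};\tau)$, $|\alpha|-|\tau|=t$, $p\nmid k_\alpha$. Define $D_{\mathbf{g},\mathbf{g},\tau}=\sum_{t=0}^{n_{\mathbf{g},\mathbf{g},\tau}}\sum_{\alpha\in\mathcal{U}_{\mathbf{g},\mathbf{g},\tau,t}}(\overline{ -1})^t\,\overline{k_\alpha}^{ -1}B_{\mathbf{g},\mathbf{g},\alpha}$. -}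

module Defs where

open import Level using (Level; _⊔_) renaming (suc to lsuc)
open import Algebra.Bundles using (CommutativeRing)
open import Data.Nat using (ℕ; zero; suc; _∸_; _<ᵇ_; _≡ᵇ_) renaming (_+_ to _+ℕ_; _*_ to _*ℕ_)
open import Data.Nat.Divisibility using (_∣_; _∣?_)
open import Data.Nat.Primality using (Prime)
open import Data.Fin using (Fin; zero; suc)
import Data.Fin
open import Data.Fin.Subset using (Subset; _⊆_; _∩_; ∣_∣)
open import Data.Fin.Subset.Properties using (_⊆?_)
open import Data.Bool using (Bool; true; false; _∧_; not; if_then_else_)
import Data.Bool as B
open import Data.Vec using (Vec; []; _∷_; tabulate; lookup)
import Data.Vec.Properties as VP
open import Data.List using (List; []; _∷_; [_]; map; concatMap; foldr; filterᵇ; allFin; cartesianProduct; upTo)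
open import Data.Bool.ListAction using (all; any)
open import Data.Product using (_×_; _,_; proj₁; proj₂)
open import Data.Sum using (_⊎_)
open import Relation.Nullary using (¬_)
open import Relation.Nullary.Decidable using (⌊_⌋)
open import Relation.Binary.PropositionalEquality using (_≡_)
open import Function using (_∘_; _⇔_)

record Field (c ℓ : Level) : Set (lsuc (c ⊔ ℓ)) where
  field
    commutativeRing : CommutativeRing c ℓ
  open CommutativeRing commutativeRing public
  field
    _⁻¹     : Carrier → Carrier
    ⁻¹-cong : ∀ {x y} → x ≈ y → x ⁻¹ ≈ y ⁻¹
    inverse : ∀ x → ¬ (x ≈ 0#) → x * (x ⁻¹) ≈ 1#
    0≉1     : ¬ (0# ≈ 1#)

module _ {c ℓ : Level} (F : Field c ℓ) where
  open Field F
  ι : ℕ → Carrier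
  ι zero    = 0#
  ι (suc k) = 1# + ι k

  HasChar : ℕ → Set ℓ
  HasChar p = (p ≡ 0 ⊎ Prime p) × (∀ a → (ι a ≈ 0#) ⇔ (p ∣ a))

consF : ∀ {a} {n} {A : Fin (suc n) → Set a} → A zero → ((i : Fin n) → A (suc i)) → (i : Fin (suc n)) → A i
consF h t zero    = h
consF h t (suc i) = t i

allFuns : ∀ {a} (n : ℕ) (A : Fin n → Set a) → ((i : Fin n) → List (A i)) → List ((i : Fin n) → A i)
allFuns zero    A es = [ (λ ()) ]
allFuns (suc n) A es =
  concatMap (λ h → map (λ t → consF {A = A} h t) (allFuns n (A ∘ suc) (es ∘ suc))) (es zero)

allSubsets : (n : ℕ) → List (Subset n)
allSubsets zero    = [ [] ]
allSubsets (suc n) = concatMap (λ s → (true ∷ s) ∷ (false ∷ s) ∷ []) (allSubsets n)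

data Idx : Set where
  i0 i1 i2 : Idx

_==_ : Idx → Idx → Bool
i0 == i0 = true
i1 == i1 = true
i2 == i2 = true
_  == _  = false

allIdx : List Idx
allIdx = i0 ∷ i1 ∷ i2 ∷ []

Triple : ℕ → Set
Triple n = Subset n × Subset n × Subset n

_⪯_ : ∀ {n} → Triple n → Triple n → Set
(U , V , W) ⪯ (U' , V' , W') = (U ⊆ U') × (V ⊆ V') × (W ⊆ W')

_⪯ᵇ_ : ∀ {n} → Triple n → Triple n → Bool
(U , V , W) ⪯ᵇ (U' , V' , W') = ⌊ U ⊆? U' ⌋ ∧ ⌊ V ⊆? V' ⌋ ∧ ⌊ W ⊆? W' ⌋

size : ∀ {n} → Triple n → ℕ
size (U , V , W) = ∣ U ∣ +ℕ ∣ V ∣ +ℕ ∣ W ∣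

_=ᵀ_ : ∀ {n} → Triple n → Triple n → Bool
(U , V , W) =ᵀ (U' , V' , W') =
  ⌊ VP.≡-dec B._≟_ U U' ⌋ ∧ ⌊ VP.≡-dec B._≟_ V V' ⌋ ∧ ⌊ VP.≡-dec B._≟_ W W' ⌋

allTriples : (n : ℕ) → List (Triple n)
allTriples n = concatMap (λ U → concatMap (λ V → map (λ W → U , V , W) (allSubsets n)) (allSubsets n)) (allSubsets n)

prodFin : (n : ℕ) → (Fin n → ℕ) → ℕ
prodFin n f = foldr (λ i r → f i *ℕ r) 1 (allFin n)

module Setup {c ℓ : Level} (F : Field c ℓ) (n : ℕ) (L M : Fin n → ℕ) where
  open Field F

  -- U_i : a set of size ℓ_i m_i partitioned into ℓ_i blocks of size m_i,
  -- realised as (block, position in block)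
  U : Fin n → Set
  U i = Fin (L i) × Fin (M i)

  allU : (i : Fin n) → List (U i)
  allU i = cartesianProduct (allFin (L i)) (allFin (M i))

  eqF : ∀ {k} → Fin k → Fin k → Bool
  eqF a b = ⌊ a Data.Fin.≟ b ⌋

  inR : (i : Fin n) → Idx → U i → U i → Bool
  inR i i0 (a , s) (b , t) = eqF a b ∧ eqF s t
  inR i i1 (a , s) (b , t) = eqF a b ∧ not (eqF s t)
  inR i i2 (a , s) (b , t) = not (eqF a b)

  X : Set
  X = (i : Fin n) → U i

  allX : List X
  allX = allFuns n U allU

  E : Set
  E = Fin n → Idx

  allE : List E
  allE = allFuns n (λ _ → Idx) (λ _ → allIdx)

  inRg : E → X → X → Bool
  inRg g a b = all (λ i → inR i (g i) (a i) (b i)) (allFin n)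

  Mat : Set c
  Mat = X → X → Carrier

  _≈ᴹ_ : Mat → Mat → Set ℓ
  P ≈ᴹ Q = ∀ y z → P y z ≈ Q y z

  OM : Mat
  OM _ _ = 0#

  sumL : ∀ {a} {A : Set a} → List A → (A → Carrier) → Carrier
  sumL xs f = foldr (λ a r → f a + r) 0# xs

  msum : ∀ {a} {A : Set a} → List A → (A → Mat) → Mat
  msum xs f y z = sumL xs (λ a → f a y z)

  _·ᴹ_ : Mat → Mat → Mat
  (P ·ᴹ Q) y z = sumL allX (λ w → P y w * Q w z)

  _∙ᴹ_ : Carrier → Mat → Mat
  (λ' ∙ᴹ P) y z = λ' * P y z

  bit : Bool → Carrier
  bit true  = 1#
  bit false = 0#

  pow : Carrier → ℕ → Carrier
  pow a zero    = 1#
  pow a (suc t) = a * pow a t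

  A : E → Mat
  A g y z = bit (inRg g y z)

  S : Idx → E → Subset n
  S j g = tabulate (λ a → g a == j)

  bul : Subset n → Subset n
  bul V = tabulate (λ a → lookup V a ∧ (2 <ᵇ L a))

  cir : Subset n → Subset n
  cir V = tabulate (λ a → lookup V a ∧ (2 <ᵇ M a))

  k : Triple n → ℕ
  k (Us , V , W) = prodFin n (λ j →
      (if lookup Us j then M j ∸ 1 else 1)
      *ℕ (if lookup V j then (L j ∸ 1) *ℕ M j else 1)
      *ℕ (if lookup W j ∧ not (lookup V j) then M j else 1))

  InU : E → E → Triple n → Set
  InU g h (J₁ , J₂ , J₃) =
    (J₁ ⊆ cir (S i1 g ∩ S i1 h)) × (J₂ ⊆ bul (S i2 g ∩ S i2 h))
    × (J₂ ⊆ J₃) × (J₃ ⊆ (S i2 g ∩ S i2 h))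

  module AtVertex (x : X) where

    eqX : X → X → Bool
    eqX a b = all (λ i → eqF (proj₁ (a i)) (proj₁ (b i)) ∧ eqF (proj₂ (a i)) (proj₂ (b i))) (allFin n)

    Estar : E → Mat
    Estar g y z = bit (eqX y z ∧ inRg g x y)

    EAE : E → E → E → Mat
    EAE g a h = (Estar g ·ᴹ A a) ·ᴹ Estar h

    -- decision of E*_g A_a E*_h ≠ O: its (y,z)-entry is the 0/1 image of
    -- [(x,y) ∈ R_g][(y,z) ∈ R_a][(x,z) ∈ R_h], and 0 ≠ 1 in F
    nonzeroᵇ : E → E → E → Bool
    nonzeroᵇ g a h = any (λ y → any (λ z → inRg g x y ∧ inRg a y z ∧ inRg h x z) allX) allX

    Bmat : E → E → Triple n → Mat
    Bmat g h (J₁ , J₂ , J₃) = msum (filterᵇ cond allE) (λ a → EAE g a h)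
      where
        cond : E → Bool
        cond a = nonzeroᵇ g a h
               ∧ ⌊ (S i1 a ∩ cir (S i1 g ∩ S i1 h)) ⊆? J₁ ⌋
               ∧ ⌊ (S i2 a ∩ bul (S i2 g ∩ S i2 h)) ⊆? J₂ ⌋
               ∧ ⌊ (S i1 a ∩ (S i2 g ∩ S i2 h)) ⊆? J₃ ⌋

    top : E → Triple n → Triple n
    top g (J₁ , J₂ , J₃) = cir (S i1 g) , bul J₃ , S i2 g

    nggτ : E → Triple n → ℕ
    nggτ g τ = size (top g τ) ∸ size τ

    -- 𝒰_{g,g,τ,t} (p is the characteristic; p ∤ k_α decided in ℕ)
    Uτt : ℕ → E → Triple n → ℕ → List (Triple n)
    Uτt p g τ t = filterᵇ
      (λ α → (τ ⪯ᵇ α) ∧ (α ⪯ᵇ top g τ) ∧ ((size α ∸ size τ) ≡ᵇ t) ∧ not ⌊ p ∣? k α ⌋)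
      (allTriples n)

    D : ℕ → E → Triple n → Mat
    D p g τ = msum (upTo (suc (nggτ g τ))) (λ t →
                msum (Uτt p g τ t) (λ α →
                  (pow (- 1#) t * (ι F (k α)) ⁻¹) ∙ᴹ Bmat g g α))

    δ : Triple n → Triple n → Carrier
    δ τ σ = bit (τ =ᵀ σ)

-- Everything factors over the coordinates.  E*_g, A_a and hence B_{g,h,τ} are
-- Kronecker products of matrices on the U_i, and so is D_{g,g,τ}: the sign
-- (-1)^(|α|-|τ|), the weight k_α⁻¹ and the condition τ ⪯ α ⪯ (g,g;τ) all split
-- coordinatewise.  At one coordinate everything lives on the subconstituent
-- R_{g_i}(x_i) and is a combination a I + b K + c J of the identity, the
-- same-block matrix and the all-ones matrix.  The admissible local triples form
-- a chain along which the normalised factors k⁻¹ B are decreasing idempotents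
-- (P_a P_b = P_(max a b)), and the local factor of D is the difference of two
-- consecutive ones.  Such differences are orthogonal idempotents, and the
-- Kronecker product of these local identities is the theorem.
module Submission where

open import Defs
open import Level using (Level)
open import Algebra.Bundles using (CommutativeSemiring; Ring)
import Algebra.Solver.Ring as RingSolver
import Algebra.Solver.Ring.AlmostCommutativeRing as ACR
open import Data.Bool using (Bool; true; false; _∧_; not; T; if_then_else_)
import Data.Bool as Bool
open import Data.Bool.ListAction using (all; any; and)
open import Data.Bool.Properties using (∨-zeroʳ; T-∧)
open import Data.Fin as Fin using (Fin; zero; suc)
open import Data.Fin.Subset using (Subset; _⊆_; _∩_; ∣_∣; inside; outside)
open import Data.Fin.Subset.Properties using (_⊆?_; p⊆q⇒∣p∣≤∣q∣)
open import Data.Integer as ℤ using (ℤ; -[1+_]) renaming (∣_∣ to ∣_∣ℤ)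
import Data.Integer.Properties as ℤ
open import Data.List as List using (List; []; _∷_; _++_; map; concatMap; filterᵇ; cartesianProduct; tabulate; allFin; upTo)
import Data.List.Properties as List
open import Data.List.Membership.Propositional using (_∈_)
import Data.List.Membership.Propositional.Properties as ∈
open import Data.List.Relation.Unary.Any as Any using (here; there)
open import Data.Maybe using (Maybe; just; nothing)
open import Data.Nat as ℕ using (ℕ; zero; suc; _∸_; _≤_; _<_; _<ᵇ_; _≡ᵇ_; _⊔_; z≤n; s≤s)
import Data.Nat.Properties as ℕ
open import Data.Nat.Divisibility using (_∣_; _∣?_; ∣m⇒∣m*n; ∣n⇒∣m*n)
open import Data.Product using (Σ-syntax; _×_; _,_; proj₁; proj₂)
open import Data.Sign as Sign using (Sign)
open import Data.Unit using (tt)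
open import Data.Vec using ([]; _∷_; lookup)
import Data.Vec.Properties as VP
open import Function using (_∘_; Equivalence)
open import Relation.Binary.PropositionalEquality as ≡ using (_≡_)
open import Relation.Nullary using (¬_; Dec; yes; no; contradiction)
open import Relation.Nullary.Decidable using (⌊_⌋; toWitness)
open import Algebra.Properties.CommutativeMonoid.Sum ℕ.+-0-commutativeMonoid using ()
  renaming (sum to ∑ℕ; ∑-distrib-+ to ∑ℕ-distrib-+)

_⇒_ : Bool → Bool → Bool
true  ⇒ b = b
false ⇒ _ = true

bools : List Bool
bools = true ∷ false ∷ []

Bits : Set
Bits = Bool × Bool × Bool

allBits : List Bits
allBits = cartesianProduct bools (cartesianProduct bools bools)

infix 8 _at_
_at_ : ∀ {n} → Triple n → Fin n → Bits
(U , V , W) at i = lookup U i , lookup V i , lookup W i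

toℕᵇ : Bool → ℕ
toℕᵇ true  = 1
toℕᵇ false = 0

∣_∣ᵇ : Bits → ℕ
∣ a , b , c ∣ᵇ = (toℕᵇ a ℕ.+ toℕᵇ b) ℕ.+ toℕᵇ c

infix 4 _⊑_
_⊑_ : Bits → Bits → Bool
(a , b , c) ⊑ (a′ , b′ , c′) = (a ⇒ a′) ∧ ((b ⇒ b′) ∧ (c ⇒ c′))

⇒-toℕᵇ : ∀ {a b} → T (a ⇒ b) → toℕᵇ a ≤ toℕᵇ b
⇒-toℕᵇ {false} _ = z≤n
⇒-toℕᵇ {true} {true} _ = s≤s z≤n

∧-split : ∀ {x y} → T (x ∧ y) → T x × T y
∧-split {x} = Equivalence.to (T-∧ {x})

⊑⇒≤ : ∀ {β β′} → T (β ⊑ β′) → ∣ β ∣ᵇ ≤ ∣ β′ ∣ᵇ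
⊑⇒≤ {a , b , c} {a′ , b′ , c′} β⊑β′ with ∧-split {a ⇒ a′} β⊑β′
... | a≤ , bc≤ with ∧-split {b ⇒ b′} bc≤
... | b≤ , c≤ = ℕ.+-mono-≤ (ℕ.+-mono-≤ (⇒-toℕᵇ {a} a≤) (⇒-toℕᵇ {b} b≤)) (⇒-toℕᵇ {c} c≤)

∣∣≡∑ℕ : ∀ {m} (P : Subset m) → ∣ P ∣ ≡ ∑ℕ (λ i → toℕᵇ (lookup P i))
∣∣≡∑ℕ []            = ≡.refl
∣∣≡∑ℕ (outside ∷ P) = ∣∣≡∑ℕ P
∣∣≡∑ℕ (inside ∷ P)  = ≡.cong suc (∣∣≡∑ℕ P)

size≡∑ℕ : ∀ {m} (σ : Triple m) → size σ ≡ ∑ℕ (λ i → ∣ σ at i ∣ᵇ)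
size≡∑ℕ (U , V , W) = begin
  (∣ U ∣ ℕ.+ ∣ V ∣) ℕ.+ ∣ W ∣                 ≡⟨ ≡.cong₂ ℕ._+_ (≡.cong₂ ℕ._+_ (∣∣≡∑ℕ U) (∣∣≡∑ℕ V)) (∣∣≡∑ℕ W) ⟩
  (∑ℕ u ℕ.+ ∑ℕ v) ℕ.+ ∑ℕ w                    ≡⟨ ≡.cong (ℕ._+ ∑ℕ w) (∑ℕ-distrib-+ u v) ⟨
  ∑ℕ (λ i → u i ℕ.+ v i) ℕ.+ ∑ℕ w            ≡⟨ ∑ℕ-distrib-+ (λ i → u i ℕ.+ v i) w ⟨
  ∑ℕ (λ i → (u i ℕ.+ v i) ℕ.+ w i)           ∎
  where
  open ≡.≡-Reasoning
  u v w : Fin _ → ℕ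
  u i = toℕᵇ (lookup U i)
  v i = toℕᵇ (lookup V i)
  w i = toℕᵇ (lookup W i)

∑ℕ-mono : ∀ {m} {f g : Fin m → ℕ} → (∀ i → f i ≤ g i) → ∑ℕ f ≤ ∑ℕ g
∑ℕ-mono {zero}  f≤g = z≤n
∑ℕ-mono {suc m} f≤g = ℕ.+-mono-≤ (f≤g zero) (∑ℕ-mono (f≤g ∘ suc))

∑ℕ-∸ : ∀ {m} (f g : Fin m → ℕ) → (∀ i → g i ≤ f i) → ∑ℕ f ∸ ∑ℕ g ≡ ∑ℕ (λ i → f i ∸ g i)
∑ℕ-∸ {zero}  f g g≤f = ≡.refl
∑ℕ-∸ {suc m} f g g≤f = begin
  (f zero ℕ.+ F) ∸ (g zero ℕ.+ G)      ≡⟨ ℕ.∸-+-assoc (f zero ℕ.+ F) (g zero) G ⟨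
  ((f zero ℕ.+ F) ∸ g zero) ∸ G        ≡⟨ ≡.cong (_∸ G) (ℕ.+-∸-comm F (g≤f zero)) ⟩
  ((f zero ∸ g zero) ℕ.+ F) ∸ G        ≡⟨ ℕ.+-∸-assoc (f zero ∸ g zero) (∑ℕ-mono (g≤f ∘ suc)) ⟩
  (f zero ∸ g zero) ℕ.+ (F ∸ G)        ≡⟨ ≡.cong ((f zero ∸ g zero) ℕ.+_) (∑ℕ-∸ (f ∘ suc) (g ∘ suc) (g≤f ∘ suc)) ⟩
  (f zero ∸ g zero) ℕ.+ ∑ℕ (λ i → f (suc i) ∸ g (suc i)) ∎
  where
  open ≡.≡-Reasoning
  F G : ℕ
  F = ∑ℕ (f ∘ suc)
  G = ∑ℕ (g ∘ suc)

⊆⇒⇒ : ∀ {m} {P Q : Subset m} → P ⊆ Q → ∀ i → T (lookup P i ⇒ lookup Q i)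
⊆⇒⇒ {P = P} {Q} P⊆Q i with lookup P i in eq
... | false = tt
... | true  = ≡.subst T (≡.sym (VP.[]=⇒lookup (P⊆Q (VP.lookup⇒[]= i P eq)))) tt

⪯ᵇ⇒⪯ : ∀ {m} {σ σ′ : Triple m} → T (σ ⪯ᵇ σ′) → σ ⪯ σ′
⪯ᵇ⇒⪯ {σ = U , V , W} {U′ , V′ , W′} t with ∧-split {⌊ U ⊆? U′ ⌋} t
... | U⊆ , VW⊆ with ∧-split {⌊ V ⊆? V′ ⌋} VW⊆
... | V⊆ , W⊆ = toWitness U⊆ , toWitness V⊆ , toWitness W⊆

⪯⇒⊑ : ∀ {m} {σ σ′ : Triple m} → σ ⪯ σ′ → ∀ i → T ((σ at i) ⊑ (σ′ at i))
⪯⇒⊑ (U⊆ , V⊆ , W⊆) i = Equivalence.from T-∧ (⊆⇒⇒ U⊆ i , Equivalence.from T-∧ (⊆⇒⇒ V⊆ i , ⊆⇒⇒ W⊆ i))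

size-mono : ∀ {m} {σ σ′ : Triple m} → σ ⪯ σ′ → size σ ≤ size σ′
size-mono (U⊆ , V⊆ , W⊆) = ℕ.+-mono-≤ (ℕ.+-mono-≤ (p⊆q⇒∣p∣≤∣q∣ U⊆) (p⊆q⇒∣p∣≤∣q∣ V⊆)) (p⊆q⇒∣p∣≤∣q∣ W⊆)

≮ᵇ⇒≡2 : ∀ {k} → 2 ≤ k → (2 <ᵇ k) ≡ false → k ≡ 2
≮ᵇ⇒≡2 2≤k e = ℕ.≤-antisym (ℕ.≮⇒≥ (λ 2<k → ≡.subst T e (ℕ.<⇒<ᵇ 2<k))) 2≤k

module _ {a} {A : Set a} where

  any-∈ : ∀ (P : A → Bool) {x xs} → x ∈ xs → P x ≡ true → any P xs ≡ true
  any-∈ P (here ≡.refl) Px rewrite Px = ≡.refl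
  any-∈ P {xs = y ∷ _} (there x∈xs) Px rewrite any-∈ P x∈xs Px = ∨-zeroʳ (P y)

allFuns-complete : ∀ {a} n (A : Fin n → Set a) (xs : ∀ i → List (A i)) (h : ∀ i → A i) →
  (∀ i → h i ∈ xs i) → Σ[ h′ ∈ (∀ i → A i) ] (h′ ∈ allFuns n A xs × (∀ i → h′ i ≡ h i))
allFuns-complete zero    A xs h h∈ = (λ ()) , here ≡.refl , λ ()
allFuns-complete (suc n) A xs h h∈ with allFuns-complete n (A ∘ suc) (xs ∘ suc) (h ∘ suc) (h∈ ∘ suc)
... | t , t∈ , t≗ = consF {A = A} (h zero) t
                  , ∈.∈-concatMap⁺ _ (Any.map (λ { ≡.refl → ∈.∈-map⁺ (consF {A = A} (h zero)) t∈ }) (h∈ zero))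
                  , λ { zero → ≡.refl ; (suc i) → t≗ i }

-- The local triples τ at a coordinate allowed by τ ∈ 𝒰_{g,g}, indexed by
-- g at that coordinate and the flags [m > 2], [ℓ > 2].
data Valid : Idx → Bool → Bool → Bits → Set where
  point  : ∀ {bM bL} → Valid i0 bM bL (false , false , false)
  block₀ : ∀ {bM bL} → Valid i1 bM bL (false , false , false)
  block₁ : ∀ {bL}    → Valid i1 true bL (true , false , false)
  far₀   : ∀ {bM bL} → Valid i2 bM bL (false , false , false)
  far₁   : ∀ {bM bL} → Valid i2 bM bL (false , false , true)
  far₂   : ∀ {bM}    → Valid i2 bM true (false , true , true)

_=ᵇ_ : Bits → Bits → Bool
(a , b , c) =ᵇ (a′ , b′ , c′) = ⌊ a Bool.≟ a′ ⌋ ∧ (⌊ b Bool.≟ b′ ⌋ ∧ ⌊ c Bool.≟ c′ ⌋)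

-- Along each local chain the size of a triple is its position.
size-injective : ∀ {gi bM bL τ σ} → Valid gi bM bL τ → Valid gi bM bL σ → (∣ τ ∣ᵇ ≡ᵇ ∣ σ ∣ᵇ) ≡ (τ =ᵇ σ)
size-injective point  point  = ≡.refl
size-injective block₀ block₀ = ≡.refl
size-injective block₀ block₁ = ≡.refl
size-injective block₁ block₀ = ≡.refl
size-injective block₁ block₁ = ≡.refl
size-injective far₀   far₀   = ≡.refl
size-injective far₀   far₁   = ≡.refl
size-injective far₀   far₂   = ≡.refl
size-injective far₁   far₀   = ≡.refl
size-injective far₁   far₁   = ≡.refl
size-injective far₁   far₂   = ≡.refl
size-injective far₂   far₀   = ≡.refl
size-injective far₂   far₁   = ≡.refl
size-injective far₂   far₂   = ≡.refl

-- The hypotheses are InU g g τ at one coordinate, hence the doubled tests on g.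
classify : ∀ gi bM bL t₁ t₂ t₃ →
           T (t₁ ⇒ (((gi == i1) ∧ (gi == i1)) ∧ bM)) → T (t₂ ⇒ (((gi == i2) ∧ (gi == i2)) ∧ bL)) →
           T (t₂ ⇒ t₃) → T (t₃ ⇒ ((gi == i2) ∧ (gi == i2))) → Valid gi bM bL (t₁ , t₂ , t₃)
classify i0 bM    bL    true  _     _     () _  _  _
classify i0 bM    bL    false true  _     _  () _  _
classify i0 bM    bL    false false true  _  _  _  ()
classify i0 bM    bL    false false false _  _  _  _  = point
classify i1 false bL    true  _     _     () _  _  _
classify i1 bM    bL    _     true  _     _  () _  _
classify i1 bM    bL    _     false true  _  _  _  ()
classify i1 true  bL    true  false false _  _  _  _  = block₁
classify i1 bM    bL    false false false _  _  _  _  = block₀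
classify i2 bM    bL    true  _     _     () _  _  _
classify i2 bM    false false true  _     _  () _  _
classify i2 bM    bL    false true  false _  _  () _
classify i2 bM    true  false true  true  _  _  _  _  = far₂
classify i2 bM    bL    false false true  _  _  _  _  = far₁
classify i2 bM    bL    false false false _  _  _  _  = far₀

module FieldProperties {c ℓ : Level} (F : Field c ℓ) where
  open Field F public hiding (zero)
  open import Relation.Binary.Reasoning.Setoid setoid public
  open import Algebra.Properties.Ring ring public using (-1*x≈-x)
  open import Algebra.Properties.AbelianGroup +-abelianGroup public
    using (⁻¹-∙-comm) renaming (⁻¹-involutive to -‿involutive; ε⁻¹≈ε to -0#≈0#)
  import Algebra.Properties.Semiring.Mult.TCOptimised semiring as Opt
  open import Algebra.Properties.CommutativeSemigroup *-commutativeSemigroup using ()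
    renaming (interchange to *-interchange)
  open import Algebra.Properties.CommutativeSemigroup +-commutativeSemigroup using ()
    renaming (interchange to +-interchange)

  ι-homo-+ : ∀ m n → ι F (m ℕ.+ n) ≈ ι F m + ι F n
  ι-homo-+ zero    n = sym (+-identityˡ _)
  ι-homo-+ (suc m) n = trans (+-congˡ (ι-homo-+ m n)) (sym (+-assoc _ _ _))

  ι-homo-* : ∀ m n → ι F (m ℕ.* n) ≈ ι F m * ι F n
  ι-homo-* zero    n = sym (zeroˡ _)
  ι-homo-* (suc m) n = begin
    ι F (n ℕ.+ m ℕ.* n)          ≈⟨ ι-homo-+ n (m ℕ.* n) ⟩
    ι F n + ι F (m ℕ.* n)        ≈⟨ +-cong (sym (*-identityˡ _)) (ι-homo-* m n) ⟩
    1# * ι F n + ι F m * ι F n   ≈⟨ distribʳ _ _ _ ⟨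
    (1# + ι F m) * ι F n         ∎

  -- The ring solver needs coefficients with decidable equality.  We use ℤ,
  -- embedded so that the coefficients 0 and 1 denote 0# and 1# on the nose.
  private
    ⟦_⟧ℕ : ℕ → Carrier
    ⟦ n ⟧ℕ = n Opt.× 1#

    ⟦_⟧ℤ : ℤ → Carrier
    ⟦ ℤ.+ n ⟧ℤ      = ⟦ n ⟧ℕ
    ⟦ -[1+ n ] ⟧ℤ = - ⟦ suc n ⟧ℕ

    ⟦suc⟧ : ∀ n → ⟦ suc n ⟧ℕ ≈ 1# + ⟦ n ⟧ℕ
    ⟦suc⟧ = Opt.×-homo-+ 1# 1

    sgn : Sign → Carrier
    sgn Sign.+ = 1#
    sgn Sign.- = - 1#

    sgn-homo : ∀ s t → sgn (s Sign.* t) ≈ sgn s * sgn t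
    sgn-homo Sign.+ t      = sym (*-identityˡ _)
    sgn-homo Sign.- Sign.+ = sym (*-identityʳ _)
    sgn-homo Sign.- Sign.- = sym (trans (-1*x≈-x (- 1#)) (-‿involutive 1#))

    ⟦◃⟧ : ∀ s n → ⟦ s ℤ.◃ n ⟧ℤ ≈ sgn s * ⟦ n ⟧ℕ
    ⟦◃⟧ s      zero    = sym (zeroʳ _)
    ⟦◃⟧ Sign.+ (suc n) = sym (*-identityˡ _)
    ⟦◃⟧ Sign.- (suc n) = sym (-1*x≈-x _)

    ⟦⟧-sign : ∀ i → ⟦ i ⟧ℤ ≈ sgn (ℤ.sign i) * ⟦ ∣ i ∣ℤ ⟧ℕ
    ⟦⟧-sign (ℤ.+ n)    = sym (*-identityˡ _)
    ⟦⟧-sign -[1+ n ] = sym (-1*x≈-x _)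

    ⟦⟧-homo-* : ∀ i j → ⟦ i ℤ.* j ⟧ℤ ≈ ⟦ i ⟧ℤ * ⟦ j ⟧ℤ
    ⟦⟧-homo-* i j = begin
      ⟦ i ℤ.* j ⟧ℤ                                       ≈⟨ ⟦◃⟧ (ℤ.sign i Sign.* ℤ.sign j) (∣ i ∣ℤ ℕ.* ∣ j ∣ℤ) ⟩
      sgn (ℤ.sign i Sign.* ℤ.sign j) * ⟦ ∣ i ∣ℤ ℕ.* ∣ j ∣ℤ ⟧ℕ  ≈⟨ *-cong (sgn-homo (ℤ.sign i) (ℤ.sign j)) (Opt.×1-homo-* ∣ i ∣ℤ ∣ j ∣ℤ) ⟩
      (sgn (ℤ.sign i) * sgn (ℤ.sign j)) * (⟦ ∣ i ∣ℤ ⟧ℕ * ⟦ ∣ j ∣ℤ ⟧ℕ) ≈⟨ *-interchange _ _ _ _ ⟩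
      (sgn (ℤ.sign i) * ⟦ ∣ i ∣ℤ ⟧ℕ) * (sgn (ℤ.sign j) * ⟦ ∣ j ∣ℤ ⟧ℕ) ≈⟨ *-cong (⟦⟧-sign i) (⟦⟧-sign j) ⟨
      ⟦ i ⟧ℤ * ⟦ j ⟧ℤ                                     ∎

    ⟦⊖⟧ : ∀ m n → ⟦ m ℤ.⊖ n ⟧ℤ ≈ ⟦ m ⟧ℕ - ⟦ n ⟧ℕ
    ⟦⊖⟧ m zero = begin
      ⟦ m ℤ.⊖ 0 ⟧ℤ   ≡⟨ ≡.cong ⟦_⟧ℤ (ℤ.⊖-≥ {m} {0} z≤n) ⟩
      ⟦ m ⟧ℕ       ≈⟨ +-identityʳ _ ⟨
      ⟦ m ⟧ℕ + 0#  ≈⟨ +-congˡ -0#≈0# ⟨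
      ⟦ m ⟧ℕ - 0#  ∎
    ⟦⊖⟧ zero (suc n) = begin
      ⟦ 0 ℤ.⊖ suc n ⟧ℤ      ≡⟨ ≡.cong ⟦_⟧ℤ (ℤ.⊖-< {0} {suc n} (s≤s z≤n)) ⟩
      - ⟦ suc n ⟧ℕ        ≈⟨ +-identityˡ _ ⟨
      0# - ⟦ suc n ⟧ℕ     ∎
    ⟦⊖⟧ (suc m) (suc n) = begin
      ⟦ suc m ℤ.⊖ suc n ⟧ℤ                ≡⟨ ≡.cong ⟦_⟧ℤ (ℤ.[1+m]⊖[1+n]≡m⊖n m n) ⟩
      ⟦ m ℤ.⊖ n ⟧ℤ                        ≈⟨ ⟦⊖⟧ m n ⟩
      ⟦ m ⟧ℕ - ⟦ n ⟧ℕ                   ≈⟨ +-identityˡ _ ⟨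
      0# + (⟦ m ⟧ℕ - ⟦ n ⟧ℕ)            ≈⟨ +-congʳ (-‿inverseʳ 1#) ⟨
      (1# - 1#) + (⟦ m ⟧ℕ - ⟦ n ⟧ℕ)     ≈⟨ +-interchange _ _ _ _ ⟩
      (1# + ⟦ m ⟧ℕ) + (- 1# - ⟦ n ⟧ℕ)   ≈⟨ +-cong (sym (⟦suc⟧ m)) (trans (⁻¹-∙-comm 1# ⟦ n ⟧ℕ) (-‿cong (sym (⟦suc⟧ n)))) ⟩
      ⟦ suc m ⟧ℕ - ⟦ suc n ⟧ℕ           ∎

    ⟦⟧-homo-+ : ∀ i j → ⟦ i ℤ.+ j ⟧ℤ ≈ ⟦ i ⟧ℤ + ⟦ j ⟧ℤ
    ⟦⟧-homo-+ (ℤ.+ m)    (ℤ.+ n)    = Opt.×-homo-+ 1# m n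
    ⟦⟧-homo-+ (ℤ.+ m)    -[1+ n ] = ⟦⊖⟧ m (suc n)
    ⟦⟧-homo-+ -[1+ m ] (ℤ.+ n)    = trans (⟦⊖⟧ n (suc m)) (+-comm _ _)
    ⟦⟧-homo-+ -[1+ m ] -[1+ n ] = begin
      - ⟦ suc (suc (m ℕ.+ n)) ⟧ℕ     ≡⟨ ≡.cong (λ k → - ⟦ suc k ⟧ℕ) (ℕ.+-suc m n) ⟨
      - ⟦ suc m ℕ.+ suc n ⟧ℕ         ≈⟨ -‿cong (Opt.×-homo-+ 1# (suc m) (suc n)) ⟩
      - (⟦ suc m ⟧ℕ + ⟦ suc n ⟧ℕ)    ≈⟨ ⁻¹-∙-comm _ _ ⟨
      - ⟦ suc m ⟧ℕ + - ⟦ suc n ⟧ℕ    ∎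

    ⟦⟧-homo-- : ∀ i → ⟦ ℤ.- i ⟧ℤ ≈ - ⟦ i ⟧ℤ
    ⟦⟧-homo-- (ℤ.+ zero)  = sym -0#≈0#
    ⟦⟧-homo-- (ℤ.+ suc n) = refl
    ⟦⟧-homo-- -[1+ n ]  = sym (-‿involutive _)

    morphism : Ring.rawRing ℤ.+-*-ring ACR.-Raw-AlmostCommutative⟶ ACR.fromCommutativeRing commutativeRing
    morphism = record
      { ⟦_⟧    = ⟦_⟧ℤ
      ; +-homo = ⟦⟧-homo-+
      ; *-homo = ⟦⟧-homo-*
      ; -‿homo = ⟦⟧-homo--
      ; 0-homo = refl
      ; 1-homo = refl
      }

    _≟ℤ_ : ∀ i j → Maybe (⟦ i ⟧ℤ ≈ ⟦ j ⟧ℤ)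
    i ≟ℤ j with i ℤ.≟ j
    ... | yes ≡.refl = just refl
    ... | no _       = nothing

  open RingSolver (Ring.rawRing ℤ.+-*-ring) (ACR.fromCommutativeRing commutativeRing) morphism _≟ℤ_ public
    using (solve; _:+_; _:*_; :-_; _:-_; _:=_; con; Polynomial)

  :0 :1 : ∀ {k} → Polynomial k
  :0 = con (ℤ.+ 0)
  :1 = con (ℤ.+ 1)


  *-≉0 : ∀ {x y} → ¬ x ≈ 0# → ¬ y ≈ 0# → ¬ x * y ≈ 0#
  *-≉0 {x} {y} x≉0 y≉0 xy≈0 = 0≉1 (begin
    0#                        ≈⟨ zeroˡ _ ⟨
    0# * (x ⁻¹ * y ⁻¹)        ≈⟨ *-congʳ xy≈0 ⟨
    (x * y) * (x ⁻¹ * y ⁻¹)   ≈⟨ *-interchange _ _ _ _ ⟩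
    (x * x ⁻¹) * (y * y ⁻¹)   ≈⟨ *-cong (inverse x x≉0) (inverse y y≉0) ⟩
    1# * 1#                   ≈⟨ *-identityˡ 1# ⟩
    1#                        ∎)

  ⁻¹-unique : ∀ {x y} → ¬ x ≈ 0# → x * y ≈ 1# → y ≈ x ⁻¹
  ⁻¹-unique {x} {y} x≉0 xy≈1 = begin
    y                 ≈⟨ *-identityʳ y ⟨
    y * 1#            ≈⟨ *-congˡ (inverse x x≉0) ⟨
    y * (x * x ⁻¹)    ≈⟨ *-assoc y x _ ⟨
    (y * x) * x ⁻¹    ≈⟨ *-congʳ (trans (*-comm y x) xy≈1) ⟩
    1# * x ⁻¹         ≈⟨ *-identityˡ _ ⟩
    x ⁻¹              ∎

  ⁻¹-distrib-* : ∀ {x y} → ¬ x ≈ 0# → ¬ y ≈ 0# → (x * y) ⁻¹ ≈ x ⁻¹ * y ⁻¹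
  ⁻¹-distrib-* {x} {y} x≉0 y≉0 = sym (⁻¹-unique (*-≉0 x≉0 y≉0) (begin
    (x * y) * (x ⁻¹ * y ⁻¹)   ≈⟨ *-interchange _ _ _ _ ⟩
    (x * x ⁻¹) * (y * y ⁻¹)   ≈⟨ *-cong (inverse x x≉0) (inverse y y≉0) ⟩
    1# * 1#                   ≈⟨ *-identityˡ 1# ⟩
    1#                        ∎))

module BigOperators {c ℓ : Level} (S : CommutativeSemiring c ℓ) where
  open CommutativeSemiring S hiding (zero)
  open import Relation.Binary.Reasoning.Setoid setoid
  open import Algebra.Properties.CommutativeSemigroup +-commutativeSemigroup using ()
    renaming (interchange to +-interchange)
  open import Algebra.Properties.CommutativeMonoid.Sum *-commutativeMonoid public using ()
    renaming (sum to ∏; sum-cong-≋ to ∏-cong; ∑-distrib-+ to ∏-distrib-*)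

  private
    variable
      a b : Level
      A B : Set a

  𝟙 : Bool → Carrier
  𝟙 true  = 1#
  𝟙 false = 0#

  𝟙-∧ : ∀ x y → 𝟙 (x ∧ y) ≈ 𝟙 x * 𝟙 y
  𝟙-∧ true  y = sym (*-identityˡ _)
  𝟙-∧ false y = sym (zeroˡ _)

  𝟙-T : ∀ {b} → T b → 𝟙 b ≈ 1#
  𝟙-T {true} _ = refl

  𝟙-idem : ∀ b → 𝟙 b * 𝟙 b ≈ 𝟙 b
  𝟙-idem true  = *-identityˡ 1#
  𝟙-idem false = zeroˡ 0#

  𝟙-guard : ∀ b {X Y} → (T b → X ≈ Y) → 𝟙 b * X ≈ 𝟙 b * Y
  𝟙-guard true  X≈Y = *-congˡ (X≈Y tt)
  𝟙-guard false X≈Y = trans (zeroˡ _) (sym (zeroˡ _))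

  𝟙-guard₂ : ∀ bu bv {X Y} → (T bu → T bv → X ≈ Y) → (𝟙 bu * 𝟙 bv) * X ≈ (𝟙 bu * 𝟙 bv) * Y
  𝟙-guard₂ true  true  X≈Y = *-congˡ (X≈Y tt tt)
  𝟙-guard₂ true  false X≈Y = trans (*-congʳ (zeroʳ _)) (trans (zeroˡ _) (sym (trans (*-congʳ (zeroʳ _)) (zeroˡ _))))
  𝟙-guard₂ false bv    X≈Y = trans (*-congʳ (zeroˡ _)) (trans (zeroˡ _) (sym (trans (*-congʳ (zeroˡ _)) (zeroˡ _))))

  𝟙-⊆? : ∀ {m} (P Q : Subset m) → 𝟙 ⌊ P ⊆? Q ⌋ ≈ ∏ (λ i → 𝟙 (lookup P i ⇒ lookup Q i))
  𝟙-⊆? []            []            = refl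
  𝟙-⊆? (outside ∷ P) (b ∷ Q)       with P ⊆? Q | 𝟙-⊆? P Q
  ... | yes _ | ih = trans ih (sym (*-identityˡ _))
  ... | no  _ | ih = trans ih (sym (*-identityˡ _))
  𝟙-⊆? (inside ∷ P)  (outside ∷ Q) = sym (zeroˡ _)
  𝟙-⊆? (inside ∷ P)  (inside ∷ Q)  with P ⊆? Q | 𝟙-⊆? P Q
  ... | yes _ | ih = trans ih (sym (*-identityˡ _))
  ... | no  _ | ih = trans ih (sym (*-identityˡ _))

  𝟙-⊆?-lookup : ∀ {m} (P Q : Subset m) {r : Fin m → Bool} → (∀ i → lookup P i ≡ r i) →
                 𝟙 ⌊ P ⊆? Q ⌋ ≈ ∏ (λ i → 𝟙 (r i ⇒ lookup Q i))
  𝟙-⊆?-lookup P Q P≗r = trans (𝟙-⊆? P Q) (∏-cong (λ i → reflexive (≡.cong (λ b → 𝟙 (b ⇒ lookup Q i)) (P≗r i))))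

  𝟙-≡-dec : ∀ {m} (U U′ : Subset m) → 𝟙 ⌊ VP.≡-dec Bool._≟_ U U′ ⌋ ≈ ∏ (λ i → 𝟙 ⌊ lookup U i Bool.≟ lookup U′ i ⌋)
  𝟙-≡-dec []      []        = refl
  𝟙-≡-dec (a ∷ U) (a′ ∷ U′) with a Bool.≟ a′ | VP.≡-dec Bool._≟_ U U′ | 𝟙-≡-dec U U′
  ... | yes _ | yes _ | ih = trans ih (sym (*-identityˡ _))
  ... | yes _ | no  _ | ih = trans ih (sym (*-identityˡ _))
  ... | no  _ | _     | _  = sym (zeroˡ _)

  ∑ : List A → (A → Carrier) → Carrier
  ∑ xs f = List.foldr (λ x r → f x + r) 0# xs

  syntax ∑ xs (λ x → e) = ∑[ x ∈ xs ] e

  ∑-cong : ∀ (xs : List A) {f g : A → Carrier} → (∀ x → f x ≈ g x) → ∑ xs f ≈ ∑ xs g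
  ∑-cong []       f≈g = refl
  ∑-cong (x ∷ xs) f≈g = +-cong (f≈g x) (∑-cong xs f≈g)

  ∑-zero : ∀ (xs : List A) {f : A → Carrier} → (∀ x → f x ≈ 0#) → ∑ xs f ≈ 0#
  ∑-zero []       f≈0 = refl
  ∑-zero (x ∷ xs) f≈0 = trans (+-cong (f≈0 x) (∑-zero xs f≈0)) (+-identityˡ 0#)

  ∑-distrib-+ : ∀ (xs : List A) (f g : A → Carrier) → ∑[ x ∈ xs ] (f x + g x) ≈ ∑ xs f + ∑ xs g
  ∑-distrib-+ []       f g = sym (+-identityˡ 0#)
  ∑-distrib-+ (x ∷ xs) f g = trans (+-congˡ (∑-distrib-+ xs f g)) (+-interchange _ _ _ _)

  *-distribˡ-∑ : ∀ (xs : List A) k (f : A → Carrier) → k * ∑ xs f ≈ ∑[ x ∈ xs ] (k * f x)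
  *-distribˡ-∑ []       k f = zeroʳ k
  *-distribˡ-∑ (x ∷ xs) k f = trans (distribˡ _ _ _) (+-congˡ (*-distribˡ-∑ xs k f))

  *-distribʳ-∑ : ∀ (xs : List A) k (f : A → Carrier) → ∑ xs f * k ≈ ∑[ x ∈ xs ] (f x * k)
  *-distribʳ-∑ []       k f = zeroˡ k
  *-distribʳ-∑ (x ∷ xs) k f = trans (distribʳ _ _ _) (+-congˡ (*-distribʳ-∑ xs k f))

  ∑-++ : ∀ (xs ys : List A) (f : A → Carrier) → ∑ (xs ++ ys) f ≈ ∑ xs f + ∑ ys f
  ∑-++ []       ys f = sym (+-identityˡ _)
  ∑-++ (x ∷ xs) ys f = trans (+-congˡ (∑-++ xs ys f)) (sym (+-assoc _ _ _))

  ∑-map : ∀ (h : B → A) (xs : List B) (f : A → Carrier) → ∑ (map h xs) f ≡ ∑ xs (f ∘ h)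
  ∑-map h []       f = ≡.refl
  ∑-map h (x ∷ xs) f = ≡.cong (f (h x) +_) (∑-map h xs f)

  ∑-concatMap : ∀ (h : B → List A) (xs : List B) (f : A → Carrier) → ∑ (concatMap h xs) f ≈ ∑[ x ∈ xs ] ∑ (h x) f
  ∑-concatMap h []       f = refl
  ∑-concatMap h (x ∷ xs) f = trans (∑-++ (h x) (concatMap h xs) f) (+-congˡ (∑-concatMap h xs f))

  ∑-filter : ∀ (P : A → Bool) (xs : List A) (f : A → Carrier) → ∑ (filterᵇ P xs) f ≈ ∑[ x ∈ xs ] (𝟙 (P x) * f x)
  ∑-filter P []       f = refl
  ∑-filter P (x ∷ xs) f with P x
  ... | true  = +-cong (sym (*-identityˡ _)) (∑-filter P xs f)
  ... | false = trans (∑-filter P xs f) (sym (trans (+-congʳ (zeroˡ _)) (+-identityˡ _)))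

  ∑-comm : ∀ (xs : List A) (ys : List B) (f : A → B → Carrier) → ∑[ x ∈ xs ] ∑[ y ∈ ys ] f x y ≈ ∑[ y ∈ ys ] ∑[ x ∈ xs ] f x y
  ∑-comm []       ys f = sym (∑-zero ys (λ _ → refl))
  ∑-comm (x ∷ xs) ys f = trans (+-congˡ (∑-comm xs ys f)) (sym (∑-distrib-+ ys (f x) _))

  ∑-cartesianProduct : ∀ (xs : List A) (ys : List B) (f : A × B → Carrier) →
    ∑ (cartesianProduct xs ys) f ≈ ∑[ x ∈ xs ] ∑[ y ∈ ys ] f (x , y)
  ∑-cartesianProduct []       ys f = refl
  ∑-cartesianProduct (x ∷ xs) ys f = trans (∑-++ (map (x ,_) ys) _ f)
    (+-cong (reflexive (∑-map (x ,_) ys f)) (∑-cartesianProduct xs ys f))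

  ∑-allFuns : ∀ n (A : Fin n → Set a) (xs : ∀ i → List (A i)) (f : ∀ i → A i → Carrier) →
    ∑[ h ∈ allFuns n A xs ] ∏ (λ i → f i (h i)) ≈ ∏ (λ i → ∑ (xs i) (f i))
  ∑-allFuns zero    A xs f = +-identityʳ 1#
  ∑-allFuns (suc n) A xs f = begin
    ∑ (concatMap (λ h → map (consF {A = A} h) tails) (xs zero)) F
      ≈⟨ ∑-concatMap _ (xs zero) F ⟩
    ∑[ h ∈ xs zero ] ∑ (map (consF {A = A} h) tails) F
      ≈⟨ ∑-cong (xs zero) (λ h → reflexive (∑-map (consF {A = A} h) tails F)) ⟩
    ∑[ h ∈ xs zero ] ∑[ t ∈ tails ] (f zero h * ∏ (λ i → f (suc i) (t i)))
      ≈⟨ ∑-cong (xs zero) (λ h → sym (*-distribˡ-∑ tails (f zero h) _)) ⟩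
    ∑[ h ∈ xs zero ] (f zero h * ∑[ t ∈ tails ] ∏ (λ i → f (suc i) (t i)))
      ≈⟨ ∑-cong (xs zero) (λ h → *-congˡ (∑-allFuns n (A ∘ suc) (xs ∘ suc) (f ∘ suc))) ⟩
    ∑[ h ∈ xs zero ] (f zero h * ∏ (λ i → ∑ (xs (suc i)) (f (suc i))))
      ≈⟨ *-distribʳ-∑ (xs zero) _ (f zero) ⟨
    ∑ (xs zero) (f zero) * ∏ (λ i → ∑ (xs (suc i)) (f (suc i))) ∎
    where
    tails : List (∀ i → A (suc i))
    tails = allFuns n (A ∘ suc) (xs ∘ suc)
    F : (∀ i → A i) → Carrier
    F h = ∏ (λ i → f i (h i))

  ∑-allSubsets : ∀ n (f : Fin n → Bool → Carrier) →
    ∑[ s ∈ allSubsets n ] ∏ (λ i → f i (lookup s i)) ≈ ∏ (λ i → ∑ bools (f i))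
  ∑-allSubsets zero    f = +-identityʳ 1#
  ∑-allSubsets (suc n) f = begin
    ∑ (concatMap (λ s → (true ∷ s) ∷ (false ∷ s) ∷ []) (allSubsets n)) F  ≈⟨ ∑-concatMap _ (allSubsets n) F ⟩
    ∑[ s ∈ allSubsets n ] ∑[ b ∈ bools ] (f zero b * R s)               ≈⟨ ∑-cong (allSubsets n) (λ s → *-distribʳ-∑ bools (R s) (f zero)) ⟨
    ∑[ s ∈ allSubsets n ] (∑ bools (f zero) * R s)                       ≈⟨ *-distribˡ-∑ (allSubsets n) _ R ⟨
    ∑ bools (f zero) * ∑ (allSubsets n) R                                ≈⟨ *-congˡ (∑-allSubsets n (f ∘ suc)) ⟩
    ∑ bools (f zero) * ∏ (λ i → ∑ bools (f (suc i)))                     ∎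
    where
    F : Subset (suc n) → Carrier
    F s = ∏ (λ i → f i (lookup s i))
    R : Subset n → Carrier
    R s = ∏ (λ i → f (suc i) (lookup s i))

  ∑-allTriples : ∀ n (f : Fin n → Bits → Carrier) →
    ∑[ α ∈ allTriples n ] ∏ (λ i → f i (α at i)) ≈ ∏ (λ i → ∑ allBits (f i))
  ∑-allTriples n f = begin
    ∑[ α ∈ allTriples n ] F α
      ≈⟨ ∑-concatMap _ (allSubsets n) F ⟩
    ∑[ U ∈ allSubsets n ] ∑ (concatMap (λ V → map (λ W → U , V , W) (allSubsets n)) (allSubsets n)) F
      ≈⟨ ∑-cong (allSubsets n) (λ U → ∑-concatMap _ (allSubsets n) F) ⟩
    ∑[ U ∈ allSubsets n ] ∑[ V ∈ allSubsets n ] ∑ (map (λ W → U , V , W) (allSubsets n)) F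
      ≈⟨ ∑-cong (allSubsets n) (λ U → ∑-cong (allSubsets n) (λ V →
           trans (reflexive (∑-map _ (allSubsets n) F)) (∑-allSubsets n (λ i c → f i (lookup U i , lookup V i , c))))) ⟩
    ∑[ U ∈ allSubsets n ] ∑[ V ∈ allSubsets n ] ∏ (λ i → ∑[ c ∈ bools ] f i (lookup U i , lookup V i , c))
      ≈⟨ ∑-cong (allSubsets n) (λ U → ∑-allSubsets n (λ i b → ∑[ c ∈ bools ] f i (lookup U i , b , c))) ⟩
    ∑[ U ∈ allSubsets n ] ∏ (λ i → ∑[ b ∈ bools ] ∑[ c ∈ bools ] f i (lookup U i , b , c))
      ≈⟨ ∑-allSubsets n (λ i a → ∑[ b ∈ bools ] ∑[ c ∈ bools ] f i (a , b , c)) ⟩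
    ∏ (λ i → ∑[ a ∈ bools ] ∑[ b ∈ bools ] ∑[ c ∈ bools ] f i (a , b , c))
      ≈⟨ ∏-cong (λ i → sym (flatten (f i))) ⟩
    ∏ (λ i → ∑ allBits (f i)) ∎
    where
    F : Triple n → Carrier
    F α = ∏ (λ i → f i (α at i))
    flatten : ∀ (g : Bits → Carrier) → ∑ allBits g ≈ ∑[ a ∈ bools ] ∑[ b ∈ bools ] ∑[ c ∈ bools ] g (a , b , c)
    flatten g = trans (∑-cartesianProduct bools (cartesianProduct bools bools) g)
                      (∑-cong bools (λ a → ∑-cartesianProduct bools bools (λ bc → g (a , bc))))

  𝟙-∧-∏ : ∀ {n} a b c (x y z : Fin n → Bool) → 𝟙 a ≈ ∏ (𝟙 ∘ x) → 𝟙 b ≈ ∏ (𝟙 ∘ y) → 𝟙 c ≈ ∏ (𝟙 ∘ z) →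
          𝟙 (a ∧ b ∧ c) ≈ ∏ (λ i → 𝟙 (x i ∧ y i ∧ z i))
  𝟙-∧-∏ a b c x y z a≈ b≈ c≈ = begin
    𝟙 (a ∧ b ∧ c)                              ≈⟨ trans (𝟙-∧ a _) (*-congˡ (𝟙-∧ b c)) ⟩
    𝟙 a * (𝟙 b * 𝟙 c)                          ≈⟨ *-cong a≈ (*-cong b≈ c≈) ⟩
    ∏ (𝟙 ∘ x) * (∏ (𝟙 ∘ y) * ∏ (𝟙 ∘ z))        ≈⟨ *-congˡ (∏-distrib-* (𝟙 ∘ y) (𝟙 ∘ z)) ⟨
    ∏ (𝟙 ∘ x) * ∏ (λ i → 𝟙 (y i) * 𝟙 (z i))    ≈⟨ ∏-distrib-* (𝟙 ∘ x) _ ⟨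
    ∏ (λ i → 𝟙 (x i) * (𝟙 (y i) * 𝟙 (z i)))    ≈⟨ ∏-cong (λ i → trans (𝟙-∧ (x i) _) (*-congˡ (𝟙-∧ (y i) (z i)))) ⟨
    ∏ (λ i → 𝟙 (x i ∧ y i ∧ z i))              ∎

module Characteristic {c ℓ : Level} (F : Field c ℓ) (p : ℕ) (hc : HasChar F p) where
  open FieldProperties F
  open BigOperators commutativeSemiring using (𝟙; ∏)

  ∣⇒ι≈0 : ∀ {k} → p ∣ k → ι F k ≈ 0#
  ∣⇒ι≈0 = Equivalence.from (proj₂ hc _)

  ∤⇒ι≉0 : ∀ {k} → ¬ p ∣ k → ¬ ι F k ≈ 0#
  ∤⇒ι≉0 p∤k ι≈0 = p∤k (Equivalence.to (proj₂ hc _) ι≈0)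

  -- The coefficient D gives to k_α: the inverse of ι k, or 0 when p ∣ k
  -- (those α are left out of D).
  recip : ℕ → Carrier
  recip k = 𝟙 (not ⌊ p ∣? k ⌋) * ι F k ⁻¹

  recip-∣ : ∀ {k} → p ∣ k → recip k ≈ 0#
  recip-∣ {k} p∣k with p ∣? k
  ... | yes _   = zeroˡ _
  ... | no  p∤k = contradiction p∣k p∤k

  recip-∤ : ∀ {k} → ¬ p ∣ k → recip k ≈ ι F k ⁻¹
  recip-∤ {k} p∤k with p ∣? k
  ... | yes p∣k = contradiction p∣k p∤k
  ... | no  _   = *-identityˡ _

  ι*recip : ∀ {k} → ¬ p ∣ k → ι F k * recip k ≈ 1#
  ι*recip {k} p∤k = trans (*-congˡ (recip-∤ p∤k)) (inverse _ (∤⇒ι≉0 p∤k))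

  ι*recip² : ∀ k → ι F k * (recip k * recip k) ≈ recip k
  ι*recip² k = go (p ∣? k)
    where
    go : Dec (p ∣ k) → ι F k * (recip k * recip k) ≈ recip k
    go (yes p∣k) = trans (*-congˡ (trans (*-congˡ (recip-∣ p∣k)) (zeroʳ _))) (trans (zeroʳ _) (sym (recip-∣ p∣k)))
    go (no p∤k)  = trans (sym (*-assoc _ _ _)) (trans (*-congʳ (ι*recip p∤k)) (*-identityˡ _))

  recip-homo-* : ∀ a b → recip (a ℕ.* b) ≈ recip a * recip b
  recip-homo-* a b = go (p ∣? a) (p ∣? b)
    where
    go : Dec (p ∣ a) → Dec (p ∣ b) → recip (a ℕ.* b) ≈ recip a * recip b
    go (yes p∣a) _ = trans (recip-∣ (∣m⇒∣m*n b p∣a)) (sym (trans (*-congʳ (recip-∣ p∣a)) (zeroˡ _)))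
    go (no _) (yes p∣b) = trans (recip-∣ (∣n⇒∣m*n a p∣b)) (sym (trans (*-congˡ (recip-∣ p∣b)) (zeroʳ _)))
    go (no p∤a) (no p∤b) = begin
      recip (a ℕ.* b)             ≈⟨ recip-∤ p∤ab ⟩
      ι F (a ℕ.* b) ⁻¹            ≈⟨ ⁻¹-cong (ι-homo-* a b) ⟩
      (ι F a * ι F b) ⁻¹          ≈⟨ ⁻¹-distrib-* (∤⇒ι≉0 p∤a) (∤⇒ι≉0 p∤b) ⟩
      ι F a ⁻¹ * ι F b ⁻¹         ≈⟨ *-cong (recip-∤ p∤a) (recip-∤ p∤b) ⟨
      recip a * recip b           ∎
      where
      p∤ab : ¬ p ∣ a ℕ.* b
      p∤ab p∣ab = *-≉0 (∤⇒ι≉0 p∤a) (∤⇒ι≉0 p∤b) (trans (sym (ι-homo-* a b)) (∣⇒ι≈0 p∣ab))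

  recip-1 : recip 1 ≈ 1#
  recip-1 = begin
    recip 1      ≈⟨ recip-∤ p∤1 ⟩
    ι F 1 ⁻¹     ≈⟨ ⁻¹-unique ι1≉0 (trans (*-identityʳ _) (+-identityʳ 1#)) ⟨
    1#           ∎
    where
    ι1≉0 : ¬ ι F 1 ≈ 0#
    ι1≉0 ι1≈0 = 0≉1 (sym (trans (sym (+-identityʳ 1#)) ι1≈0))
    p∤1 : ¬ p ∣ 1
    p∤1 = ι1≉0 ∘ ∣⇒ι≈0

  recip-prodFin : ∀ n (f : Fin n → ℕ) → recip (prodFin n f) ≈ ∏ (recip ∘ f)
  recip-prodFin n f = go n (λ i → i)
    where
    go : ∀ m (h : Fin m → Fin n) → recip (List.foldr (λ i r → f i ℕ.* r) 1 (tabulate h)) ≈ ∏ (recip ∘ f ∘ h)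
    go zero    h = recip-1
    go (suc m) h = trans (recip-homo-* (f (h zero)) _) (*-congˡ (go m (h ∘ suc)))

  ι*recip-absorb : ∀ m k → ι F m * (recip m * recip (k ℕ.* m)) ≈ recip (k ℕ.* m)
  ι*recip-absorb m k = go (p ∣? m)
    where
    go : Dec (p ∣ m) → ι F m * (recip m * recip (k ℕ.* m)) ≈ recip (k ℕ.* m)
    go (yes p∣m) = trans (*-congˡ (trans (*-congˡ (recip-∣ (∣n⇒∣m*n k p∣m))) (zeroʳ _)))
                         (trans (zeroʳ _) (sym (recip-∣ (∣n⇒∣m*n k p∣m))))
    go (no p∤m)  = trans (sym (*-assoc _ _ _)) (trans (*-congʳ (ι*recip p∤m)) (*-identityˡ _))

-- Coefficients (a , b , c) of a I + b K + c J, where I is the identity, K the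
-- "same block" matrix and J the all-ones matrix on a subconstituent.  When
-- K² = μ K, K J = J K = μ J and J² = ν J these multiply by _⊗⟨_,_⟩_.
module IKJ {c ℓ : Level} (F : Field c ℓ) where
  open FieldProperties F
  open BigOperators commutativeSemiring using (𝟙)

  Coeffs : Set c
  Coeffs = Carrier × Carrier × Carrier

  infix 4 _≈₃_
  _≈₃_ : Coeffs → Coeffs → Set ℓ
  (a , b , c) ≈₃ (a′ , b′ , c′) = (a ≈ a′) × (b ≈ b′) × (c ≈ c′)

  ≈₃-trans : ∀ {s t u} → s ≈₃ t → t ≈₃ u → s ≈₃ u
  ≈₃-trans {_ , _ , _} {_ , _ , _} {_ , _ , _} (p , q , r) (p′ , q′ , r′) = trans p p′ , trans q q′ , trans r r′

  0₃ I₃ K₃ J₃ : Coeffs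
  0₃ = 0# , 0# , 0#
  I₃ = 1# , 0# , 0#
  K₃ = 0# , 1# , 0#
  J₃ = 0# , 0# , 1#

  infixl 7 _·₃_
  _·₃_ : Carrier → Coeffs → Coeffs
  r ·₃ (a , b , c) = r * a , r * b , r * c

  infixl 6 _-₃_
  _-₃_ : Coeffs → Coeffs → Coeffs
  (a , b , c) -₃ (a′ , b′ , c′) = a - a′ , b - b′ , c - c′

  _⊗⟨_,_⟩_ : Coeffs → Carrier → Carrier → Coeffs → Coeffs
  (a , b , c) ⊗⟨ μ , ν ⟩ (a′ , b′ , c′) =
    a * a′ , (a * b′ + b * a′) + μ * (b * b′) , ((a * c′ + c * a′) + μ * (b * c′ + c * b′)) + ν * (c * c′)

  -₃-cong : ∀ {s s′ t t′} → s ≈₃ s′ → t ≈₃ t′ → s -₃ t ≈₃ s′ -₃ t′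
  -₃-cong {_ , _ , _} {_ , _ , _} {_ , _ , _} {_ , _ , _} (p , q , r) (p′ , q′ , r′) =
    +-cong p (-‿cong p′) , +-cong q (-‿cong q′) , +-cong r (-‿cong r′)

  ⊗-identityˡ : ∀ μ ν t → I₃ ⊗⟨ μ , ν ⟩ t ≈₃ t
  ⊗-identityˡ μ ν (a , b , c) =
    solve 1 (λ a → :1 :* a := a) refl a ,
    solve 3 (λ μ a b → (:1 :* b :+ :0 :* a) :+ μ :* (:0 :* b) := b) refl μ a b ,
    solve 5 (λ μ ν a b c → ((:1 :* c :+ :0 :* a) :+ μ :* (:0 :* c :+ :0 :* b)) :+ ν :* (:0 :* c) := c) refl μ ν a b c

  ⊗-identityʳ : ∀ μ ν t → t ⊗⟨ μ , ν ⟩ I₃ ≈₃ t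
  ⊗-identityʳ μ ν (a , b , c) =
    solve 1 (λ a → a :* :1 := a) refl a ,
    solve 3 (λ μ a b → (a :* :0 :+ b :* :1) :+ μ :* (b :* :0) := b) refl μ a b ,
    solve 5 (λ μ ν a b c → ((a :* :0 :+ c :* :1) :+ μ :* (b :* :0 :+ c :* :0)) :+ ν :* (c :* :0) := c) refl μ ν a b c

  ⊗-zeroˡ : ∀ μ ν t → 0₃ ⊗⟨ μ , ν ⟩ t ≈₃ 0₃
  ⊗-zeroˡ μ ν (a , b , c) =
    solve 1 (λ a → :0 :* a := :0) refl a ,
    solve 3 (λ μ a b → (:0 :* b :+ :0 :* a) :+ μ :* (:0 :* b) := :0) refl μ a b ,
    solve 5 (λ μ ν a b c → ((:0 :* c :+ :0 :* a) :+ μ :* (:0 :* c :+ :0 :* b)) :+ ν :* (:0 :* c) := :0) refl μ ν a b c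

  ⊗-zeroʳ : ∀ μ ν t → t ⊗⟨ μ , ν ⟩ 0₃ ≈₃ 0₃
  ⊗-zeroʳ μ ν (a , b , c) =
    solve 1 (λ a → a :* :0 := :0) refl a ,
    solve 3 (λ μ a b → (a :* :0 :+ b :* :0) :+ μ :* (b :* :0) := :0) refl μ a b ,
    solve 5 (λ μ ν a b c → ((a :* :0 :+ c :* :0) :+ μ :* (b :* :0 :+ c :* :0)) :+ ν :* (c :* :0) := :0) refl μ ν a b c

  ⊗-distribˡ-₃ : ∀ μ ν s t u → s ⊗⟨ μ , ν ⟩ (t -₃ u) ≈₃ s ⊗⟨ μ , ν ⟩ t -₃ s ⊗⟨ μ , ν ⟩ u
  ⊗-distribˡ-₃ μ ν (a , b , c) (d , e , f) (d′ , e′ , f′) =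
    solve 3 (λ a d d′ → a :* (d :- d′) := a :* d :- a :* d′) refl a d d′ ,
    solve 7 (λ μ a b d e d′ e′ → (a :* (e :- e′) :+ b :* (d :- d′)) :+ μ :* (b :* (e :- e′))
                                 := ((a :* e :+ b :* d) :+ μ :* (b :* e)) :- ((a :* e′ :+ b :* d′) :+ μ :* (b :* e′)))
            refl μ a b d e d′ e′ ,
    solve 11 (λ μ ν a b c d e f d′ e′ f′ →
                ((a :* (f :- f′) :+ c :* (d :- d′)) :+ μ :* (b :* (f :- f′) :+ c :* (e :- e′))) :+ ν :* (c :* (f :- f′))
             := (((a :* f :+ c :* d) :+ μ :* (b :* f :+ c :* e)) :+ ν :* (c :* f))
                :- (((a :* f′ :+ c :* d′) :+ μ :* (b :* f′ :+ c :* e′)) :+ ν :* (c :* f′)))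
            refl μ ν a b c d e f d′ e′ f′

  ⊗-distribʳ-₃ : ∀ μ ν s t u → (t -₃ u) ⊗⟨ μ , ν ⟩ s ≈₃ t ⊗⟨ μ , ν ⟩ s -₃ u ⊗⟨ μ , ν ⟩ s
  ⊗-distribʳ-₃ μ ν (a , b , c) (d , e , f) (d′ , e′ , f′) =
    solve 3 (λ a d d′ → (d :- d′) :* a := d :* a :- d′ :* a) refl a d d′ ,
    solve 7 (λ μ a b d e d′ e′ → ((d :- d′) :* b :+ (e :- e′) :* a) :+ μ :* ((e :- e′) :* b)
                                 := ((d :* b :+ e :* a) :+ μ :* (e :* b)) :- ((d′ :* b :+ e′ :* a) :+ μ :* (e′ :* b)))
            refl μ a b d e d′ e′ ,
    solve 11 (λ μ ν a b c d e f d′ e′ f′ →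
                (((d :- d′) :* c :+ (f :- f′) :* a) :+ μ :* ((e :- e′) :* c :+ (f :- f′) :* b)) :+ ν :* ((f :- f′) :* c)
             := (((d :* c :+ f :* a) :+ μ :* (e :* c :+ f :* b)) :+ ν :* (f :* c))
                :- (((d′ :* c :+ f′ :* a) :+ μ :* (e′ :* c :+ f′ :* b)) :+ ν :* (f′ :* c)))
            refl μ ν a b c d e f d′ e′ f′

  ·₃-congʳ : ∀ {r r′} t → r ≈ r′ → r ·₃ t ≈₃ r′ ·₃ t
  ·₃-congʳ (a , b , c) r≈r′ = *-congʳ r≈r′ , *-congʳ r≈r′ , *-congʳ r≈r′

  K⊗K : ∀ μ ν r s → (r ·₃ K₃) ⊗⟨ μ , ν ⟩ (s ·₃ K₃) ≈₃ (μ * (r * s)) ·₃ K₃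
  K⊗K μ ν r s =
    solve 3 (λ μ r s → (r :* :0) :* (s :* :0) := (μ :* (r :* s)) :* :0) refl μ r s ,
    solve 3 (λ μ r s → ((r :* :0) :* (s :* :1) :+ (r :* :1) :* (s :* :0)) :+ μ :* ((r :* :1) :* (s :* :1))
                       := (μ :* (r :* s)) :* :1) refl μ r s ,
    solve 4 (λ μ ν r s → (((r :* :0) :* (s :* :0) :+ (r :* :0) :* (s :* :0))
                          :+ μ :* ((r :* :1) :* (s :* :0) :+ (r :* :0) :* (s :* :1))) :+ ν :* ((r :* :0) :* (s :* :0))
                         := (μ :* (r :* s)) :* :0) refl μ ν r s

  K⊗J : ∀ μ ν r s → (r ·₃ K₃) ⊗⟨ μ , ν ⟩ (s ·₃ J₃) ≈₃ (μ * (r * s)) ·₃ J₃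
  K⊗J μ ν r s =
    solve 3 (λ μ r s → (r :* :0) :* (s :* :0) := (μ :* (r :* s)) :* :0) refl μ r s ,
    solve 3 (λ μ r s → ((r :* :0) :* (s :* :0) :+ (r :* :1) :* (s :* :0)) :+ μ :* ((r :* :1) :* (s :* :0))
                       := (μ :* (r :* s)) :* :0) refl μ r s ,
    solve 4 (λ μ ν r s → (((r :* :0) :* (s :* :1) :+ (r :* :0) :* (s :* :0))
                          :+ μ :* ((r :* :1) :* (s :* :1) :+ (r :* :0) :* (s :* :0))) :+ ν :* ((r :* :0) :* (s :* :1))
                         := (μ :* (r :* s)) :* :1) refl μ ν r s

  J⊗K : ∀ μ ν r s → (r ·₃ J₃) ⊗⟨ μ , ν ⟩ (s ·₃ K₃) ≈₃ (μ * (r * s)) ·₃ J₃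
  J⊗K μ ν r s =
    solve 3 (λ μ r s → (r :* :0) :* (s :* :0) := (μ :* (r :* s)) :* :0) refl μ r s ,
    solve 3 (λ μ r s → ((r :* :0) :* (s :* :1) :+ (r :* :0) :* (s :* :0)) :+ μ :* ((r :* :0) :* (s :* :1))
                       := (μ :* (r :* s)) :* :0) refl μ r s ,
    solve 4 (λ μ ν r s → (((r :* :0) :* (s :* :0) :+ (r :* :1) :* (s :* :0))
                          :+ μ :* ((r :* :0) :* (s :* :0) :+ (r :* :1) :* (s :* :1))) :+ ν :* ((r :* :1) :* (s :* :0))
                         := (μ :* (r :* s)) :* :1) refl μ ν r s

  J⊗J : ∀ μ ν r s → (r ·₃ J₃) ⊗⟨ μ , ν ⟩ (s ·₃ J₃) ≈₃ (ν * (r * s)) ·₃ J₃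
  J⊗J μ ν r s =
    solve 3 (λ ν r s → (r :* :0) :* (s :* :0) := (ν :* (r :* s)) :* :0) refl ν r s ,
    solve 4 (λ μ ν r s → ((r :* :0) :* (s :* :0) :+ (r :* :0) :* (s :* :0)) :+ μ :* ((r :* :0) :* (s :* :0))
                         := (ν :* (r :* s)) :* :0) refl μ ν r s ,
    solve 4 (λ μ ν r s → (((r :* :0) :* (s :* :1) :+ (r :* :1) :* (s :* :0))
                          :+ μ :* ((r :* :0) :* (s :* :1) :+ (r :* :1) :* (s :* :0))) :+ ν :* ((r :* :1) :* (s :* :1))
                         := (ν :* (r :* s)) :* :1) refl μ ν r s

  private
    u-v-[v-v] : ∀ u v → (u -₃ v) -₃ (v -₃ v) ≈₃ 1# ·₃ (u -₃ v)
    u-v-[v-v] (a , b , c) (a′ , b′ , c′) = lemma a a′ , lemma b b′ , lemma c c′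
      where
      lemma : ∀ x y → (x - y) - (y - y) ≈ 1# * (x - y)
      lemma = solve 2 (λ x y → (x :- y) :- (y :- y) := :1 :* (x :- y)) refl

    u-v-[u-v] : ∀ u v w → (u -₃ v) -₃ (u -₃ v) ≈₃ 0# ·₃ w
    u-v-[u-v] (a , b , c) (a′ , b′ , c′) (d , e , f) = lemma a a′ d , lemma b b′ e , lemma c c′ f
      where
      lemma : ∀ x y z → (x - y) - (x - y) ≈ 0# * z
      lemma = solve 3 (λ x y z → (x :- y) :- (x :- y) := :0 :* z) refl

    u-u-[v-v] : ∀ u v w → (u -₃ u) -₃ (v -₃ v) ≈₃ 0# ·₃ w
    u-u-[v-v] (a , b , c) (a′ , b′ , c′) (d , e , f) = lemma a a′ d , lemma b b′ e , lemma c c′ f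
      where
      lemma : ∀ x y z → (x - x) - (y - y) ≈ 0# * z
      lemma = solve 3 (λ x y z → (x :- x) :- (y :- y) := :0 :* z) refl

  Δ : (ℕ → Coeffs) → ℕ → Coeffs
  Δ P r = P r -₃ P (suc r)

  module _ (μ ν : Carrier) where

    private
      Δ⊗Δ : ∀ P → (∀ a b → P a ⊗⟨ μ , ν ⟩ P b ≈₃ P (a ⊔ b)) → ∀ r s →
            Δ P r ⊗⟨ μ , ν ⟩ Δ P s ≈₃ (P (r ⊔ s) -₃ P (r ⊔ suc s)) -₃ (P (suc r ⊔ s) -₃ P (suc r ⊔ suc s))
      Δ⊗Δ P P⊗P r s =
        ≈₃-trans (⊗-distribʳ-₃ μ ν (Δ P s) (P r) (P (suc r)))
                 (-₃-cong (≈₃-trans (⊗-distribˡ-₃ μ ν (P r) (P s) (P (suc s))) (-₃-cong (P⊗P r s) (P⊗P r (suc s))))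
                          (≈₃-trans (⊗-distribˡ-₃ μ ν (P (suc r)) (P s) (P (suc s)))
                                    (-₃-cong (P⊗P (suc r) s) (P⊗P (suc r) (suc s)))))

    chain-orthogonal : ∀ (P : ℕ → Coeffs) → (∀ a b → P a ⊗⟨ μ , ν ⟩ P b ≈₃ P (a ⊔ b)) →
                       ∀ r s → Δ P r ⊗⟨ μ , ν ⟩ Δ P s ≈₃ 𝟙 (r ≡ᵇ s) ·₃ Δ P r
    chain-orthogonal P P⊗P (suc r) (suc s) = chain-orthogonal (λ a → P (suc a)) (λ a b → P⊗P (suc a) (suc b)) r s
    chain-orthogonal P P⊗P zero          zero    = ≈₃-trans (Δ⊗Δ P P⊗P 0 0) (u-v-[v-v] (P 0) (P 1))
    chain-orthogonal P P⊗P zero          (suc s) = ≈₃-trans (Δ⊗Δ P P⊗P 0 (suc s)) (u-v-[u-v] (P (suc s)) _ (Δ P 0))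
    chain-orthogonal P P⊗P (suc zero)    zero    = ≈₃-trans (Δ⊗Δ P P⊗P 1 0) (u-u-[v-v] (P 1) (P 2) (Δ P 1))
    chain-orthogonal P P⊗P (suc (suc r)) zero    = ≈₃-trans (Δ⊗Δ P P⊗P (suc (suc r)) 0) (u-u-[v-v] _ _ (Δ P (suc (suc r))))

module Factorisation {c ℓ : Level} (F : Field c ℓ) (n : ℕ) (L M : Fin n → ℕ) where
  open FieldProperties F
  open BigOperators commutativeSemiring
  open Setup F n L M

  bit≡𝟙 : ∀ b → bit b ≡ 𝟙 b
  bit≡𝟙 true  = ≡.refl
  bit≡𝟙 false = ≡.refl

  eqF-suc : ∀ {k} (a b : Fin k) → eqF (suc a) (suc b) ≡ eqF a b
  eqF-suc a b with a Fin.≟ b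
  ... | yes _ = ≡.refl
  ... | no  _ = ≡.refl

  eqF-sym : ∀ {k} (a b : Fin k) → eqF a b ≡ eqF b a
  eqF-sym zero    zero    = ≡.refl
  eqF-sym zero    (suc b) = ≡.refl
  eqF-sym (suc a) zero    = ≡.refl
  eqF-sym (suc a) (suc b) = ≡.trans (eqF-suc a b) (≡.trans (eqF-sym a b) (≡.sym (eqF-suc b a)))

  eqF⇒≡ : ∀ {k} {a b : Fin k} → T (eqF a b) → a ≡ b
  eqF⇒≡ = toWitness

  eqF-refl : ∀ {k} (a : Fin k) → eqF a a ≡ true
  eqF-refl a with a Fin.≟ a
  ... | yes _   = ≡.refl
  ... | no  a≢a = contradiction ≡.refl a≢a

  eqF-via : ∀ {k} {c a b : Fin k} → T (eqF c a) → T (eqF c b) → eqF a b ≡ true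
  eqF-via c~a c~b with eqF⇒≡ c~a | eqF⇒≡ c~b
  ... | ≡.refl | ≡.refl = eqF-refl _

  eqF-Fin2 : ∀ {k} → k ≡ 2 → (c a b : Fin k) → T (not (eqF c a)) → T (not (eqF c b)) → eqF a b ≡ true
  eqF-Fin2 ≡.refl zero       zero       _          () _
  eqF-Fin2 ≡.refl zero       (suc zero) zero       _  ()
  eqF-Fin2 ≡.refl zero       (suc zero) (suc zero) _  _ = ≡.refl
  eqF-Fin2 ≡.refl (suc zero) zero       zero       _  _ = ≡.refl
  eqF-Fin2 ≡.refl (suc zero) zero       (suc zero) _  ()
  eqF-Fin2 ≡.refl (suc zero) (suc zero) _          () _

  ∑-allFin-suc : ∀ k (f : Fin (suc k) → Carrier) → ∑ (allFin (suc k)) f ≡ f zero + ∑ (allFin k) (f ∘ suc)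
  ∑-allFin-suc k f = ≡.cong (f zero +_) (≡.trans (≡.cong (λ xs → ∑ xs f) (≡.sym (List.map-tabulate (λ i → i) suc)))
                                                  (∑-map suc (allFin k) f))

  ∑-δ : ∀ {k} (a : Fin k) (f : Fin k → Carrier) → ∑[ b ∈ allFin k ] (𝟙 (eqF a b) * f b) ≈ f a
  ∑-δ {suc k} zero f = begin
    ∑[ b ∈ allFin (suc k) ] (𝟙 (eqF zero b) * f b)       ≡⟨ ∑-allFin-suc k _ ⟩
    1# * f zero + ∑[ b ∈ allFin k ] (0# * f (suc b))     ≈⟨ +-cong (*-identityˡ _) (∑-zero (allFin k) (λ _ → zeroˡ _)) ⟩
    f zero + 0#                                          ≈⟨ +-identityʳ _ ⟩
    f zero                                               ∎
  ∑-δ {suc k} (suc a) f = begin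
    ∑[ b ∈ allFin (suc k) ] (𝟙 (eqF (suc a) b) * f b)
      ≡⟨ ∑-allFin-suc k _ ⟩
    0# * f zero + ∑[ b ∈ allFin k ] (𝟙 (eqF (suc a) (suc b)) * f (suc b))
      ≈⟨ +-cong (zeroˡ _) (∑-cong (allFin k) (λ b → *-congʳ (reflexive (≡.cong 𝟙 (eqF-suc a b))))) ⟩
    0# + ∑[ b ∈ allFin k ] (𝟙 (eqF a b) * f (suc b))
      ≈⟨ +-congˡ (∑-δ a (f ∘ suc)) ⟩
    0# + f (suc a)
      ≈⟨ +-identityˡ _ ⟩
    f (suc a) ∎

  ∑-const : ∀ k c → ∑[ b ∈ allFin k ] c ≈ ι F k * c
  ∑-const zero    c = sym (zeroˡ c)
  ∑-const (suc k) c = begin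
    ∑[ b ∈ allFin (suc k) ] c   ≡⟨ ∑-allFin-suc k _ ⟩
    c + ∑[ b ∈ allFin k ] c     ≈⟨ +-cong (sym (*-identityˡ c)) (∑-const k c) ⟩
    1# * c + ι F k * c          ≈⟨ distribʳ _ _ _ ⟨
    ι F (suc k) * c             ∎

  ∑-≢ : ∀ {k} (a : Fin k) → ∑[ b ∈ allFin k ] 𝟙 (not (eqF a b)) ≈ ι F (k ∸ 1)
  ∑-≢ {suc k} zero = begin
    ∑[ b ∈ allFin (suc k) ] 𝟙 (not (eqF zero b))   ≡⟨ ∑-allFin-suc k _ ⟩
    0# + ∑[ b ∈ allFin k ] 1#                      ≈⟨ +-identityˡ _ ⟩
    ∑[ b ∈ allFin k ] 1#                           ≈⟨ ∑-const k 1# ⟩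
    ι F k * 1#                                     ≈⟨ *-identityʳ _ ⟩
    ι F k                                          ∎
  ∑-≢ {suc (suc k)} (suc a) = begin
    ∑[ b ∈ allFin (suc (suc k)) ] 𝟙 (not (eqF (suc a) b))
      ≡⟨ ∑-allFin-suc (suc k) _ ⟩
    1# + ∑[ b ∈ allFin (suc k) ] 𝟙 (not (eqF (suc a) (suc b)))
      ≈⟨ +-congˡ (∑-cong (allFin (suc k)) (λ b → reflexive (≡.cong (𝟙 ∘ not) (eqF-suc a b)))) ⟩
    1# + ∑[ b ∈ allFin (suc k) ] 𝟙 (not (eqF a b))
      ≈⟨ +-congˡ (∑-≢ a) ⟩
    1# + ι F k ∎

  Factors : Set c
  Factors = (i : Fin n) → U i → U i → Carrier

  infix 4 _≈⊗_
  _≈⊗_ : Mat → Factors → Set ℓ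
  P ≈⊗ f = ∀ y z → P y z ≈ ∏ (λ i → f i (y i) (z i))

  _⊙_ : Factors → Factors → Factors
  (f ⊙ g) i u v = ∑[ w ∈ allU i ] (f i u w * g i w v)

  ·ᴹ-⊗ : ∀ {P Q f g} → P ≈⊗ f → Q ≈⊗ g → (P ·ᴹ Q) ≈⊗ (f ⊙ g)
  ·ᴹ-⊗ {P} {Q} {f} {g} P≈ Q≈ y z = begin
    ∑[ w ∈ allX ] (P y w * Q w z)
      ≈⟨ ∑-cong allX (λ w → trans (*-cong (P≈ y w) (Q≈ w z)) (sym (∏-distrib-* (λ i → f i (y i) (w i)) (λ i → g i (w i) (z i))))) ⟩
    ∑[ w ∈ allX ] ∏ (λ i → f i (y i) (w i) * g i (w i) (z i))
      ≈⟨ ∑-allFuns n U allU (λ i w → f i (y i) w * g i w (z i)) ⟩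
    ∏ (λ i → (f ⊙ g) i (y i) (z i)) ∎

  ≈⊗-trans : ∀ {P f g} → P ≈⊗ f → (∀ i u v → f i u v ≈ g i u v) → P ≈⊗ g
  ≈⊗-trans P≈ f≈g y z = trans (P≈ y z) (∏-cong (λ i → f≈g i (y i) (z i)))

  𝟙-all : ∀ (f : Fin n → Bool) → 𝟙 (all f (allFin n)) ≈ ∏ (𝟙 ∘ f)
  𝟙-all f = go n (λ i → i)
    where
    go : ∀ m (h : Fin m → Fin n) → 𝟙 (all f (tabulate h)) ≈ ∏ (𝟙 ∘ f ∘ h)
    go zero    h = refl
    go (suc m) h = trans (𝟙-∧ (f (h zero)) _) (*-congˡ (go m (h ∘ suc)))

  ∑-U-δ : ∀ i (u : U i) (f : U i → Carrier) → ∑[ w ∈ allU i ] (𝟙 (inR i i0 u w) * f w) ≈ f u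
  ∑-U-δ i (a , s) f = begin
    ∑[ w ∈ allU i ] (𝟙 (inR i i0 (a , s) w) * f w)
      ≈⟨ ∑-cartesianProduct (allFin (L i)) (allFin (M i)) _ ⟩
    ∑[ b ∈ allFin (L i) ] ∑[ t ∈ allFin (M i) ] (𝟙 (eqF a b ∧ eqF s t) * f (b , t))
      ≈⟨ ∑-cong (allFin (L i)) (λ b → trans (∑-cong (allFin (M i)) (λ t → trans (*-congʳ (𝟙-∧ (eqF a b) _)) (*-assoc _ _ _)))
                                             (sym (*-distribˡ-∑ (allFin (M i)) _ _))) ⟩
    ∑[ b ∈ allFin (L i) ] (𝟙 (eqF a b) * ∑[ t ∈ allFin (M i) ] (𝟙 (eqF s t) * f (b , t)))
      ≈⟨ ∑-cong (allFin (L i)) (λ b → *-congˡ (∑-δ s (λ t → f (b , t)))) ⟩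
    ∑[ b ∈ allFin (L i) ] (𝟙 (eqF a b) * f (b , s))
      ≈⟨ ∑-δ a (λ b → f (b , s)) ⟩
    f (a , s) ∎

  ∑-U-δ′ : ∀ i (v : U i) (f : U i → Carrier) → ∑[ w ∈ allU i ] (f w * 𝟙 (inR i i0 w v)) ≈ f v
  ∑-U-δ′ i v f = trans (∑-cong (allU i) (λ w → trans (*-comm _ _) (*-congʳ (reflexive (≡.cong 𝟙 (symmetric w))))))
                       (∑-U-δ i v f)
    where
    symmetric : ∀ w → inR i i0 w v ≡ inR i i0 v w
    symmetric (b , t) = ≡.cong₂ _∧_ (eqF-sym b (proj₁ v)) (eqF-sym t (proj₂ v))

  Aᶠ : E → Factors
  Aᶠ a i u v = 𝟙 (inR i (a i) u v)

  A-⊗ : ∀ a → A a ≈⊗ Aᶠ a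
  A-⊗ a y z = trans (reflexive (bit≡𝟙 (inRg a y z))) (𝟙-all (λ i → inR i (a i) (y i) (z i)))

  lookup-S : ∀ j g i → lookup (S j g) i ≡ (g i == j)
  lookup-S j g = VP.lookup∘tabulate _

  lookup-∩ : ∀ (P Q : Subset n) i → lookup (P ∩ Q) i ≡ lookup P i ∧ lookup Q i
  lookup-∩ P Q i = VP.lookup-zipWith _∧_ i P Q

  lookup-cir : ∀ V i → lookup (cir V) i ≡ lookup V i ∧ (2 <ᵇ M i)
  lookup-cir V = VP.lookup∘tabulate _

  lookup-bul : ∀ V i → lookup (bul V) i ≡ lookup V i ∧ (2 <ᵇ L i)
  lookup-bul V = VP.lookup∘tabulate _

  -- The three conditions on a in B_{g,h,τ}, read at one coordinate.
  admissible : Idx → Idx → Bool → Bool → Bits → Idx → Bool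
  admissible gi hi bM bL (b₁ , b₂ , b₃) j =
      (((j == i1) ∧ (((gi == i1) ∧ (hi == i1)) ∧ bM)) ⇒ b₁)
    ∧ ((((j == i2) ∧ (((gi == i2) ∧ (hi == i2)) ∧ bL)) ⇒ b₂)
    ∧ (((j == i1) ∧ ((gi == i2) ∧ (hi == i2))) ⇒ b₃))

  InU⇒Valid : ∀ g τ → InU g g τ → ∀ i → Valid (g i) (2 <ᵇ M i) (2 <ᵇ L i) (τ at i)
  InU⇒Valid g (J₁ , J₂ , J₃) (J₁⊆ , J₂⊆ , J₂⊆J₃ , J₃⊆) i =
    classify (g i) _ _ _ _ _
      (≡.subst (λ b → T (lookup J₁ i ⇒ b)) e₁ (⊆⇒⇒ J₁⊆ i))
      (≡.subst (λ b → T (lookup J₂ i ⇒ b)) e₂ (⊆⇒⇒ J₂⊆ i))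
      (⊆⇒⇒ J₂⊆J₃ i)
      (≡.subst (λ b → T (lookup J₃ i ⇒ b)) e₃ (⊆⇒⇒ J₃⊆ i))
    where
    e₁ : lookup (cir (S i1 g ∩ S i1 g)) i ≡ ((g i == i1) ∧ (g i == i1)) ∧ (2 <ᵇ M i)
    e₁ rewrite lookup-cir (S i1 g ∩ S i1 g) i | lookup-∩ (S i1 g) (S i1 g) i | lookup-S i1 g i = ≡.refl
    e₂ : lookup (bul (S i2 g ∩ S i2 g)) i ≡ ((g i == i2) ∧ (g i == i2)) ∧ (2 <ᵇ L i)
    e₂ rewrite lookup-bul (S i2 g ∩ S i2 g) i | lookup-∩ (S i2 g) (S i2 g) i | lookup-S i2 g i = ≡.refl
    e₃ : lookup (S i2 g ∩ S i2 g) i ≡ (g i == i2) ∧ (g i == i2)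
    e₃ rewrite lookup-∩ (S i2 g) (S i2 g) i | lookup-S i2 g i = ≡.refl

  δ-⊗ : ∀ (τ σ : Triple n) → bit (τ =ᵀ σ) ≈ ∏ (λ i → 𝟙 ((τ at i) =ᵇ (σ at i)))
  δ-⊗ (U , V , W) (U′ , V′ , W′) = trans (reflexive (bit≡𝟙 ((U , V , W) =ᵀ (U′ , V′ , W′))))
    (𝟙-∧-∏ ⌊ VP.≡-dec Bool._≟_ U U′ ⌋ ⌊ VP.≡-dec Bool._≟_ V V′ ⌋ ⌊ VP.≡-dec Bool._≟_ W W′ ⌋
           (λ i → ⌊ lookup U i Bool.≟ lookup U′ i ⌋) (λ i → ⌊ lookup V i Bool.≟ lookup V′ i ⌋)
           (λ i → ⌊ lookup W i Bool.≟ lookup W′ i ⌋)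
           (𝟙-≡-dec U U′) (𝟙-≡-dec V V′) (𝟙-≡-dec W W′))

  module _ (x : X) where
    open AtVertex x

    support : Idx → (i : Fin n) → U i → Carrier
    support gi i u = 𝟙 (inR i gi (x i) u)

    ρ : Idx → Idx → Idx → (i : Fin n) → U i → U i → Carrier
    ρ gi j hi i u v = (support gi i u * 𝟙 (inR i j u v)) * support hi i v

    E*ᶠ : E → Factors
    E*ᶠ g i u v = 𝟙 (inR i i0 u v) * support (g i) i u

    E*-⊗ : ∀ g → Estar g ≈⊗ E*ᶠ g
    E*-⊗ g y z = begin
      bit (eqX y z ∧ inRg g x y)      ≡⟨ bit≡𝟙 (eqX y z ∧ inRg g x y) ⟩
      𝟙 (eqX y z ∧ inRg g x y)        ≈⟨ 𝟙-∧ (eqX y z) _ ⟩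
      𝟙 (eqX y z) * 𝟙 (inRg g x y)    ≈⟨ *-cong (𝟙-all (λ i → inR i i0 (y i) (z i))) (𝟙-all (λ i → inR i (g i) (x i) (y i))) ⟩
      ∏ (λ i → 𝟙 (inR i i0 (y i) (z i))) * ∏ (λ i → support (g i) i (y i))
        ≈⟨ ∏-distrib-* (λ i → 𝟙 (inR i i0 (y i) (z i))) (λ i → support (g i) i (y i)) ⟨
      ∏ (λ i → 𝟙 (inR i i0 (y i) (z i)) * support (g i) i (y i)) ∎

    E*Aᶠ : E → E → Factors
    E*Aᶠ g a i u v = support (g i) i u * Aᶠ a i u v

    E*A-⊗ : ∀ g a → (Estar g ·ᴹ A a) ≈⊗ E*Aᶠ g a
    E*A-⊗ g a = ≈⊗-trans (·ᴹ-⊗ {f = E*ᶠ g} {g = Aᶠ a} (E*-⊗ g) (A-⊗ a)) collapse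
      where
      collapse : ∀ i u v → ∑[ w ∈ allU i ] (E*ᶠ g i u w * Aᶠ a i w v) ≈ E*Aᶠ g a i u v
      collapse i u v = trans (∑-cong (allU i) (λ w → *-assoc _ _ _)) (∑-U-δ i u (λ w → support (g i) i u * Aᶠ a i w v))

    E*AE*-⊗ : ∀ g a h → EAE g a h ≈⊗ (λ i → ρ (g i) (a i) (h i) i)
    E*AE*-⊗ g a h = ≈⊗-trans (·ᴹ-⊗ {f = E*Aᶠ g a} {g = E*ᶠ h} (E*A-⊗ g a) (E*-⊗ h)) collapse
      where
      collapse : ∀ i u v → ∑[ w ∈ allU i ] (E*Aᶠ g a i u w * E*ᶠ h i w v) ≈ ρ (g i) (a i) (h i) i u v
      collapse i u v = trans (∑-cong (allU i) (λ w → trans (*-congˡ (*-comm _ _)) (sym (*-assoc _ _ _))))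
                             (∑-U-δ′ i v (ρ (g i) (a i) (h i) i u))

    E*AE*-entry : ∀ g a h y z → EAE g a h y z ≈ 𝟙 (inRg g x y ∧ inRg a y z ∧ inRg h x z)
    E*AE*-entry g a h y z = begin
      EAE g a h y z                                       ≈⟨ E*AE*-⊗ g a h y z ⟩
      ∏ (λ i → (sg i * r i) * sh i)                       ≈⟨ ∏-cong (λ i → *-assoc (sg i) (r i) (sh i)) ⟩
      ∏ (λ i → sg i * (r i * sh i))                       ≈⟨ ∏-distrib-* sg _ ⟩
      ∏ sg * ∏ (λ i → r i * sh i)                         ≈⟨ *-congˡ (∏-distrib-* r sh) ⟩
      ∏ sg * (∏ r * ∏ sh)                                 ≈⟨ *-cong (𝟙-all _) (*-cong (𝟙-all _) (𝟙-all _)) ⟨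
      𝟙 (inRg g x y) * (𝟙 (inRg a y z) * 𝟙 (inRg h x z))  ≈⟨ trans (𝟙-∧ (inRg g x y) _) (*-congˡ (𝟙-∧ (inRg a y z) _)) ⟨
      𝟙 (inRg g x y ∧ inRg a y z ∧ inRg h x z)            ∎
      where
      sg sh r : Fin n → Carrier
      sg i = support (g i) i (y i)
      sh i = support (h i) i (z i)
      r  i = 𝟙 (inR i (a i) (y i) (z i))

    inRg-cong : ∀ g {a a′ b b′ : X} → (∀ i → a i ≡ a′ i) → (∀ i → b i ≡ b′ i) → inRg g a b ≡ inRg g a′ b′
    inRg-cong g a≗ b≗ = ≡.cong and (List.map-cong (λ i → ≡.cong₂ (inR i (g i)) (a≗ i) (b≗ i)) (allFin n))

    allX-complete : ∀ (y : X) → Σ[ y′ ∈ X ] (y′ ∈ allX × (∀ i → y′ i ≡ y i))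
    allX-complete y = allFuns-complete n U allU y (λ i → ∈.∈-cartesianProduct⁺ (∈.∈-allFin _) (∈.∈-allFin _))

    E*AE*-vanishes : ∀ g a h → nonzeroᵇ g a h ≡ false → ∀ y z → EAE g a h y z ≈ 0#
    E*AE*-vanishes g a h nz≡false y z with allX-complete y | allX-complete z
    ... | y′ , y′∈ , y′≗ | z′ , z′∈ , z′≗ = begin
      EAE g a h y z        ≈⟨ E*AE*-entry g a h y z ⟩
      𝟙 (entry y z)        ≡⟨ ≡.cong 𝟙 (≡.sym same-entry) ⟩
      𝟙 (entry y′ z′)      ≡⟨ ≡.cong 𝟙 entry≡false ⟩
      0#                   ∎
      where
      entry : X → X → Bool
      entry y z = inRg g x y ∧ inRg a y z ∧ inRg h x z
      same-entry : entry y′ z′ ≡ entry y z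
      same-entry = ≡.cong₂ _∧_ (inRg-cong g (λ _ → ≡.refl) y′≗)
                     (≡.cong₂ _∧_ (inRg-cong a y′≗ z′≗) (inRg-cong h (λ _ → ≡.refl) z′≗))
      entry≡false : entry y′ z′ ≡ false
      entry≡false with entry y′ z′ in eq
      ... | false = ≡.refl
      ... | true  = contradiction (≡.trans (≡.sym nz≡false) (any-∈ _ y′∈ (any-∈ _ z′∈ eq))) λ ()

    Bᶠ : Idx → Idx → Bool → Bool → Bits → (i : Fin n) → U i → U i → Carrier
    Bᶠ gi hi bM bL β i u v = ∑[ j ∈ allIdx ] (𝟙 (admissible gi hi bM bL β j) * ρ gi j hi i u v)

    B-⊗ : ∀ g h τ → Bmat g h τ ≈⊗ (λ i → Bᶠ (g i) (h i) (2 <ᵇ M i) (2 <ᵇ L i) (τ at i) i)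
    B-⊗ g h τ@(J₁ , J₂ , J₃) y z = begin
      Bmat g h τ y z
        ≈⟨ ∑-filter (λ a → nonzeroᵇ g a h ∧ conditions a) allE (λ a → EAE g a h y z) ⟩
      ∑[ a ∈ allE ] (𝟙 (nonzeroᵇ g a h ∧ conditions a) * EAE g a h y z)
        ≈⟨ ∑-cong allE (λ a → trans (drop-nonzero a) (*-cong (𝟙-conditions a) (E*AE*-⊗ g a h y z))) ⟩
      ∑[ a ∈ allE ] (∏ (adm a) * ∏ (λ i → r i (a i)))
        ≈⟨ ∑-cong allE (λ a → sym (∏-distrib-* (adm a) (λ i → r i (a i)))) ⟩
      ∑[ a ∈ allE ] ∏ (λ i → adm a i * r i (a i))
        ≈⟨ ∑-allFuns n (λ _ → Idx) (λ _ → allIdx) (λ i j → 𝟙 (admissibleᵢ i j) * r i j) ⟩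
      ∏ (λ i → Bᶠ (g i) (h i) (2 <ᵇ M i) (2 <ᵇ L i) (τ at i) i (y i) (z i)) ∎
      where
      conditions : E → Bool
      conditions a = ⌊ (S i1 a ∩ cir (S i1 g ∩ S i1 h)) ⊆? J₁ ⌋
                   ∧ ⌊ (S i2 a ∩ bul (S i2 g ∩ S i2 h)) ⊆? J₂ ⌋
                   ∧ ⌊ (S i1 a ∩ (S i2 g ∩ S i2 h)) ⊆? J₃ ⌋
      admissibleᵢ : Fin n → Idx → Bool
      admissibleᵢ i = admissible (g i) (h i) (2 <ᵇ M i) (2 <ᵇ L i) (τ at i)
      adm : E → Fin n → Carrier
      adm a i = 𝟙 (admissibleᵢ i (a i))
      r : (i : Fin n) → Idx → Carrier
      r i j = ρ (g i) j (h i) i (y i) (z i)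

      drop-nonzero : ∀ a → 𝟙 (nonzeroᵇ g a h ∧ conditions a) * EAE g a h y z ≈ 𝟙 (conditions a) * EAE g a h y z
      drop-nonzero a with nonzeroᵇ g a h in nz
      ... | true  = refl
      ... | false = trans (zeroˡ _) (sym (trans (*-congˡ (E*AE*-vanishes g a h nz y z)) (zeroʳ _)))

      𝟙-conditions : ∀ a → 𝟙 (conditions a) ≈ ∏ (adm a)
      𝟙-conditions a =
        𝟙-∧-∏ ⌊ P₁ ⊆? J₁ ⌋ ⌊ P₂ ⊆? J₂ ⌋ ⌊ P₃ ⊆? J₃ ⌋
              (λ i → r₁ i ⇒ lookup J₁ i) (λ i → r₂ i ⇒ lookup J₂ i) (λ i → r₃ i ⇒ lookup J₃ i)
              (𝟙-⊆?-lookup P₁ J₁ e₁) (𝟙-⊆?-lookup P₂ J₂ e₂) (𝟙-⊆?-lookup P₃ J₃ e₃)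
        where
        P₁ P₂ P₃ : Subset n
        P₁ = S i1 a ∩ cir (S i1 g ∩ S i1 h)
        P₂ = S i2 a ∩ bul (S i2 g ∩ S i2 h)
        P₃ = S i1 a ∩ (S i2 g ∩ S i2 h)
        r₁ r₂ r₃ : Fin n → Bool
        r₁ i = (a i == i1) ∧ (((g i == i1) ∧ (h i == i1)) ∧ (2 <ᵇ M i))
        r₂ i = (a i == i2) ∧ (((g i == i2) ∧ (h i == i2)) ∧ (2 <ᵇ L i))
        r₃ i = (a i == i1) ∧ ((g i == i2) ∧ (h i == i2))
        e₁ : ∀ i → lookup P₁ i ≡ r₁ i
        e₁ i rewrite lookup-∩ (S i1 a) (cir (S i1 g ∩ S i1 h)) i | lookup-cir (S i1 g ∩ S i1 h) i
                   | lookup-∩ (S i1 g) (S i1 h) i | lookup-S i1 a i | lookup-S i1 g i | lookup-S i1 h i = ≡.refl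
        e₂ : ∀ i → lookup P₂ i ≡ r₂ i
        e₂ i rewrite lookup-∩ (S i2 a) (bul (S i2 g ∩ S i2 h)) i | lookup-bul (S i2 g ∩ S i2 h) i
                   | lookup-∩ (S i2 g) (S i2 h) i | lookup-S i2 a i | lookup-S i2 g i | lookup-S i2 h i = ≡.refl
        e₃ : ∀ i → lookup P₃ i ≡ r₃ i
        e₃ i rewrite lookup-∩ (S i1 a) (S i2 g ∩ S i2 h) i
                   | lookup-∩ (S i2 g) (S i2 h) i | lookup-S i1 a i | lookup-S i2 g i | lookup-S i2 h i = ≡.refl

module D-Factorisation {c ℓ : Level} (F : Field c ℓ) (p : ℕ) (hc : HasChar F p)
                      (n : ℕ) (L M : Fin n → ℕ) (x : Setup.X F n L M) where
  open FieldProperties F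
  open BigOperators commutativeSemiring
  open Characteristic F p hc
  open Setup F n L M
  open AtVertex x
  open Factorisation F n L M

  pow-homo-+ : ∀ a m k → pow a (m ℕ.+ k) ≈ pow a m * pow a k
  pow-homo-+ a zero    k = sym (*-identityˡ _)
  pow-homo-+ a (suc m) k = trans (*-congˡ (pow-homo-+ a m k)) (sym (*-assoc _ _ _))

  pow-∑ℕ : ∀ a {m} (f : Fin m → ℕ) → pow a (∑ℕ f) ≈ ∏ (λ i → pow a (f i))
  pow-∑ℕ a {zero}  f = refl
  pow-∑ℕ a {suc m} f = trans (pow-homo-+ a (f zero) _) (*-congˡ (pow-∑ℕ a (f ∘ suc)))

  𝟙-⪯ᵇ : ∀ (σ σ′ : Triple n) → 𝟙 (σ ⪯ᵇ σ′) ≈ ∏ (λ i → 𝟙 ((σ at i) ⊑ (σ′ at i)))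
  𝟙-⪯ᵇ (U , V , W) (U′ , V′ , W′) =
    𝟙-∧-∏ ⌊ U ⊆? U′ ⌋ ⌊ V ⊆? V′ ⌋ ⌊ W ⊆? W′ ⌋
          (λ i → lookup U i ⇒ lookup U′ i) (λ i → lookup V i ⇒ lookup V′ i) (λ i → lookup W i ⇒ lookup W′ i)
          (𝟙-⊆? U U′) (𝟙-⊆? V V′) (𝟙-⊆? W W′)

  topᶠ : Bool → Bool → Idx → Bits → Bits
  topᶠ bM bL gi (_ , _ , t₃) = (gi == i1) ∧ bM , t₃ ∧ bL , gi == i2

  top-at : ∀ g τ i → top g τ at i ≡ topᶠ (2 <ᵇ M i) (2 <ᵇ L i) (g i) (τ at i)
  top-at g (J₁ , J₂ , J₃) i =
    ≡.cong₂ _,_ (≡.trans (lookup-cir (S i1 g) i) (≡.cong (_∧ (2 <ᵇ M i)) (lookup-S i1 g i)))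
                (≡.cong₂ _,_ (lookup-bul J₃ i) (lookup-S i2 g i))

  kᶠ : Fin n → Bits → ℕ
  kᶠ i (a , b , c) = (if a then M i ∸ 1 else 1) ℕ.* (if b then (L i ∸ 1) ℕ.* M i else 1)
                     ℕ.* (if c ∧ not b then M i else 1)

  Dᶠ : Bool → Bool → Idx → Bits → (i : Fin n) → U i → U i → Carrier
  Dᶠ bM bL gi τᵢ i u v =
    ∑[ β ∈ filterᵇ (λ β → (τᵢ ⊑ β) ∧ (β ⊑ topᶠ bM bL gi τᵢ)) allBits ]
      ((pow (- 1#) (∣ β ∣ᵇ ∸ ∣ τᵢ ∣ᵇ) * recip (kᶠ i β)) * Bᶠ x gi gi bM bL β i u v)

  ∑-upTo-suc : ∀ K (f : ℕ → Carrier) → ∑ (upTo (suc K)) f ≡ f 0 + ∑ (upTo K) (f ∘ suc)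
  ∑-upTo-suc K f = ≡.cong (f 0 +_) (≡.trans (≡.cong (λ ts → ∑ ts f) (≡.sym (List.map-applyUpTo (λ t → t) suc K)))
                                             (∑-map suc (upTo K) f))

  ∑-upTo-δ : ∀ {d} K (f : ℕ → Carrier) → d < K → ∑[ t ∈ upTo K ] (𝟙 (d ≡ᵇ t) * f t) ≈ f d
  ∑-upTo-δ {zero} (suc K) f _ = begin
    ∑[ t ∈ upTo (suc K) ] (𝟙 (0 ≡ᵇ t) * f t)        ≡⟨ ∑-upTo-suc K _ ⟩
    1# * f 0 + ∑[ t ∈ upTo K ] (0# * f (suc t))     ≈⟨ +-cong (*-identityˡ _) (∑-zero (upTo K) (λ _ → zeroˡ _)) ⟩
    f 0 + 0#                                        ≈⟨ +-identityʳ _ ⟩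
    f 0                                             ∎
  ∑-upTo-δ {suc d} (suc K) f (s≤s d<K) = begin
    ∑[ t ∈ upTo (suc K) ] (𝟙 (suc d ≡ᵇ t) * f t)                 ≡⟨ ∑-upTo-suc K _ ⟩
    0# * f 0 + ∑[ t ∈ upTo K ] (𝟙 (d ≡ᵇ t) * f (suc t))         ≈⟨ +-cong (zeroˡ _) (∑-upTo-δ K (f ∘ suc) d<K) ⟩
    0# + f (suc d)                                               ≈⟨ +-identityˡ _ ⟩
    f (suc d)                                                    ∎

  interval : E → Triple n → Fin n → Bits → Bool
  interval g τ i β = ((τ at i) ⊑ β) ∧ (β ⊑ topᶠ (2 <ᵇ M i) (2 <ᵇ L i) (g i) (τ at i))

  Dterm : E → Triple n → (i : Fin n) → Bits → U i → U i → Carrier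
  Dterm g τ i β u v = (pow (- 1#) (∣ β ∣ᵇ ∸ ∣ τ at i ∣ᵇ) * recip (kᶠ i β)) * Bᶠ x (g i) (g i) (2 <ᵇ M i) (2 <ᵇ L i) β i u v

  sign-⊗ : ∀ (τ α : Triple n) → T (τ ⪯ᵇ α) →
           pow (- 1#) (size α ∸ size τ) ≈ ∏ (λ i → pow (- 1#) (∣ α at i ∣ᵇ ∸ ∣ τ at i ∣ᵇ))
  sign-⊗ τ α τ⪯α = begin
    pow (- 1#) (size α ∸ size τ)
      ≡⟨ ≡.cong₂ (λ m k → pow (- 1#) (m ∸ k)) (size≡∑ℕ α) (size≡∑ℕ τ) ⟩
    pow (- 1#) (∑ℕ (λ i → ∣ α at i ∣ᵇ) ∸ ∑ℕ (λ i → ∣ τ at i ∣ᵇ))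
      ≡⟨ ≡.cong (pow (- 1#)) (∑ℕ-∸ (λ i → ∣ α at i ∣ᵇ) (λ i → ∣ τ at i ∣ᵇ) τ≤α) ⟩
    pow (- 1#) (∑ℕ (λ i → ∣ α at i ∣ᵇ ∸ ∣ τ at i ∣ᵇ))
      ≈⟨ pow-∑ℕ (- 1#) (λ i → ∣ α at i ∣ᵇ ∸ ∣ τ at i ∣ᵇ) ⟩
    ∏ (λ i → pow (- 1#) (∣ α at i ∣ᵇ ∸ ∣ τ at i ∣ᵇ)) ∎
    where
    τ≤α : ∀ i → ∣ τ at i ∣ᵇ ≤ ∣ α at i ∣ᵇ
    τ≤α i = ⊑⇒≤ {τ at i} {α at i} (⪯⇒⊑ {σ = τ} {α} (⪯ᵇ⇒⪯ {σ = τ} τ⪯α) i)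

  𝟙-interval : ∀ g τ α → 𝟙 ((τ ⪯ᵇ α) ∧ (α ⪯ᵇ top g τ)) ≈ ∏ (λ i → 𝟙 (interval g τ i (α at i)))
  𝟙-interval g τ α = begin
    𝟙 ((τ ⪯ᵇ α) ∧ (α ⪯ᵇ top g τ))
      ≈⟨ trans (𝟙-∧ (τ ⪯ᵇ α) _) (*-cong (𝟙-⪯ᵇ τ α) (𝟙-⪯ᵇ α (top g τ))) ⟩
    ∏ (λ i → 𝟙 ((τ at i) ⊑ (α at i))) * ∏ (λ i → 𝟙 ((α at i) ⊑ (top g τ at i)))
      ≈⟨ ∏-distrib-* (λ i → 𝟙 ((τ at i) ⊑ (α at i))) (λ i → 𝟙 ((α at i) ⊑ (top g τ at i))) ⟨
    ∏ (λ i → 𝟙 ((τ at i) ⊑ (α at i)) * 𝟙 ((α at i) ⊑ (top g τ at i)))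
      ≈⟨ ∏-cong (λ i → trans (*-congˡ (reflexive (≡.cong (λ t → 𝟙 ((α at i) ⊑ t)) (top-at g τ i))))
                             (sym (𝟙-∧ ((τ at i) ⊑ (α at i)) _))) ⟩
    ∏ (λ i → 𝟙 (interval g τ i (α at i))) ∎

  -- The sum over t in D picks the single t = |α| - |τ|, which is in range
  -- because α ⪯ (g,g;τ).
  ∑-over-t : ∀ g τ α B →
    ∑[ t ∈ upTo (suc (nggτ g τ)) ]
      (𝟙 ((τ ⪯ᵇ α) ∧ (α ⪯ᵇ top g τ) ∧ ((size α ∸ size τ) ≡ᵇ t) ∧ not ⌊ p ∣? k α ⌋) * ((pow (- 1#) t * ι F (k α) ⁻¹) * B))
    ≈ 𝟙 ((τ ⪯ᵇ α) ∧ (α ⪯ᵇ top g τ)) * ((pow (- 1#) (size α ∸ size τ) * recip (k α)) * B)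
  ∑-over-t g τ α B with τ ⪯ᵇ α | α ⪯ᵇ top g τ in α⪯top
  ... | false | _     = trans (∑-zero (upTo (suc (nggτ g τ))) (λ _ → zeroˡ _)) (sym (zeroˡ _))
  ... | true  | false = trans (∑-zero (upTo (suc (nggτ g τ))) (λ _ → zeroˡ _)) (sym (zeroˡ _))
  ... | true  | true  = begin
    ∑[ t ∈ upTo K ] (𝟙 ((d ≡ᵇ t) ∧ q) * ((pow (- 1#) t * ι F (k α) ⁻¹) * B))
      ≈⟨ ∑-cong (upTo K) (λ t → trans (*-congʳ (𝟙-∧ (d ≡ᵇ t) q)) (*-assoc _ _ _)) ⟩
    ∑[ t ∈ upTo K ] (𝟙 (d ≡ᵇ t) * (𝟙 q * ((pow (- 1#) t * ι F (k α) ⁻¹) * B)))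
      ≈⟨ ∑-upTo-δ K (λ t → 𝟙 q * ((pow (- 1#) t * ι F (k α) ⁻¹) * B)) d<K ⟩
    𝟙 q * ((pow (- 1#) d * ι F (k α) ⁻¹) * B)
      ≈⟨ solve 4 (λ q s i b → q :* ((s :* i) :* b) := :1 :* ((s :* (q :* i)) :* b)) refl (𝟙 q) (pow (- 1#) d) (ι F (k α) ⁻¹) B ⟩
    1# * ((pow (- 1#) d * recip (k α)) * B) ∎
    where
    K d : ℕ
    K = suc (nggτ g τ)
    d = size α ∸ size τ
    q : Bool
    q = not ⌊ p ∣? k α ⌋
    d<K : d < K
    d<K = s≤s (ℕ.∸-monoˡ-≤ (size τ) (size-mono {σ = α} (⪯ᵇ⇒⪯ {σ = α} (≡.subst T (≡.sym α⪯top) tt))))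

  term-⊗ : ∀ g τ α y z →
    𝟙 ((τ ⪯ᵇ α) ∧ (α ⪯ᵇ top g τ)) * ((pow (- 1#) (size α ∸ size τ) * recip (k α)) * Bmat g g α y z)
      ≈ ∏ (λ i → 𝟙 (interval g τ i (α at i)) * Dterm g τ i (α at i) (y i) (z i))
  term-⊗ g τ α y z = begin
    𝟙 (Q₁ ∧ Q₂) * ((pow (- 1#) (size α ∸ size τ) * recip (k α)) * Bmat g g α y z)
      ≈⟨ 𝟙-guard (Q₁ ∧ Q₂) (λ q → *-cong (*-cong (sign-⊗ τ α (proj₁ (∧-split {Q₁} q))) (recip-prodFin n (λ i → kᶠ i (α at i))))
                                         (B-⊗ x g g α y z)) ⟩
    𝟙 (Q₁ ∧ Q₂) * ((∏ s * ∏ r) * ∏ b)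
      ≈⟨ *-cong (𝟙-interval g τ α) (trans (*-congʳ (sym (∏-distrib-* s r))) (sym (∏-distrib-* _ b))) ⟩
    ∏ (λ i → 𝟙 (interval g τ i (α at i))) * ∏ (λ i → (s i * r i) * b i)
      ≈⟨ ∏-distrib-* (λ i → 𝟙 (interval g τ i (α at i))) (λ i → (s i * r i) * b i) ⟨
    ∏ (λ i → 𝟙 (interval g τ i (α at i)) * Dterm g τ i (α at i) (y i) (z i)) ∎
    where
    Q₁ Q₂ : Bool
    Q₁ = τ ⪯ᵇ α
    Q₂ = α ⪯ᵇ top g τ
    s r b : Fin n → Carrier
    s i = pow (- 1#) (∣ α at i ∣ᵇ ∸ ∣ τ at i ∣ᵇ)
    r i = recip (kᶠ i (α at i))
    b i = Bᶠ x (g i) (g i) (2 <ᵇ M i) (2 <ᵇ L i) (α at i) i (y i) (z i)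

  D-⊗ : ∀ g τ → D p g τ ≈⊗ (λ i → Dᶠ (2 <ᵇ M i) (2 <ᵇ L i) (g i) (τ at i) i)
  D-⊗ g τ y z = begin
    D p g τ y z
      ≈⟨ ∑-cong (upTo K) (λ t → ∑-filter (cond t) (allTriples n) (term t)) ⟩
    ∑[ t ∈ upTo K ] ∑[ α ∈ allTriples n ] (𝟙 (cond t α) * term t α)
      ≈⟨ ∑-comm (upTo K) (allTriples n) (λ t α → 𝟙 (cond t α) * term t α) ⟩
    ∑[ α ∈ allTriples n ] ∑[ t ∈ upTo K ] (𝟙 (cond t α) * term t α)
      ≈⟨ ∑-cong (allTriples n) (λ α → trans (∑-over-t g τ α (Bmat g g α y z)) (term-⊗ g τ α y z)) ⟩
    ∑[ α ∈ allTriples n ] ∏ (λ i → 𝟙 (interval g τ i (α at i)) * Dterm g τ i (α at i) (y i) (z i))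
      ≈⟨ ∑-allTriples n (λ i β → 𝟙 (interval g τ i β) * Dterm g τ i β (y i) (z i)) ⟩
    ∏ (λ i → ∑[ β ∈ allBits ] (𝟙 (interval g τ i β) * Dterm g τ i β (y i) (z i)))
      ≈⟨ ∏-cong (λ i → sym (∑-filter (interval g τ i) allBits (λ β → Dterm g τ i β (y i) (z i)))) ⟩
    ∏ (λ i → Dᶠ (2 <ᵇ M i) (2 <ᵇ L i) (g i) (τ at i) i (y i) (z i)) ∎
    where
    K : ℕ
    K = suc (nggτ g τ)
    cond : ℕ → Triple n → Bool
    cond t α = (τ ⪯ᵇ α) ∧ (α ⪯ᵇ top g τ) ∧ ((size α ∸ size τ) ≡ᵇ t) ∧ not ⌊ p ∣? k α ⌋
    term : ℕ → Triple n → Carrier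
    term t α = (pow (- 1#) t * ι F (k α) ⁻¹) * Bmat g g α y z

module Subconstituent {c ℓ : Level} (F : Field c ℓ) (n : ℕ) (L M : Fin n → ℕ)
                      (x : Setup.X F n L M) (i : Fin n) where
  open FieldProperties F
  open BigOperators commutativeSemiring
  open Setup F n L M
  open Factorisation F n L M
  open IKJ F
  open import Algebra.Properties.CommutativeSemigroup *-commutativeSemigroup using (xy∙z≈xz∙y; xy∙z≈x∙zy)

  x₁ : Fin (L i)
  x₁ = proj₁ (x i)
  x₂ : Fin (M i)
  x₂ = proj₂ (x i)

  s : Idx → U i → Carrier
  s gi = support x gi i

  I K : U i → U i → Carrier
  I u v = 𝟙 (inR i i0 u v)
  K u v = 𝟙 (eqF (proj₁ u) (proj₁ v))

  comb : Coeffs → U i → U i → Carrier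
  comb (a , b , c) u v = (a * I u v + b * K u v) + c

  -- comb t restricted to the subconstituent R_gi(x i).
  ⟪_∣_⟫ : Idx → Coeffs → U i → U i → Carrier
  ⟪ gi ∣ t ⟫ u v = (s gi u * s gi v) * comb t u v

  -- μ: points of the subconstituent in a block meeting it; ν: its size.
  μ ν : Idx → Carrier
  μ i0 = 1#
  μ i1 = ι F (M i ∸ 1)
  μ i2 = ι F (M i)
  ν i0 = 1#
  ν i1 = ι F (M i ∸ 1)
  ν i2 = ι F (L i ∸ 1) * ι F (M i)

  blockᶜ : Idx → Fin (L i) → Carrier
  blockᶜ i0 a = 𝟙 (eqF x₁ a)
  blockᶜ i1 a = 𝟙 (eqF x₁ a)
  blockᶜ i2 a = 𝟙 (not (eqF x₁ a))

  positionᶜ : Idx → Fin (M i) → Carrier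
  positionᶜ i0 b = 𝟙 (eqF x₂ b)
  positionᶜ i1 b = 𝟙 (not (eqF x₂ b))
  positionᶜ i2 b = 1#

  s-split : ∀ gi a b → s gi (a , b) ≈ blockᶜ gi a * positionᶜ gi b
  s-split i0 a b = 𝟙-∧ (eqF x₁ a) _
  s-split i1 a b = 𝟙-∧ (eqF x₁ a) _
  s-split i2 a b = sym (*-identityʳ _)

  ∑-positionᶜ : ∀ gi → ∑ (allFin (M i)) (positionᶜ gi) ≈ μ gi
  ∑-positionᶜ i0 = trans (∑-cong (allFin (M i)) (λ b → sym (*-identityʳ _))) (∑-δ x₂ (λ _ → 1#))
  ∑-positionᶜ i1 = ∑-≢ x₂
  ∑-positionᶜ i2 = trans (∑-const (M i) 1#) (*-identityʳ _)

  ∑-blockᶜ : ∀ gi → ∑ (allFin (L i)) (blockᶜ gi) * μ gi ≈ ν gi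
  ∑-blockᶜ i0 = trans (*-identityʳ _) (trans (∑-cong (allFin (L i)) (λ a → sym (*-identityʳ _))) (∑-δ x₁ (λ _ → 1#)))
  ∑-blockᶜ i1 = trans (*-congʳ (trans (∑-cong (allFin (L i)) (λ a → sym (*-identityʳ _))) (∑-δ x₁ (λ _ → 1#)))) (*-identityˡ _)
  ∑-blockᶜ i2 = *-congʳ (∑-≢ x₁)

  ∑-U-split : ∀ (f : Fin (L i) → Carrier) (g : Fin (M i) → Carrier) →
              ∑[ w ∈ allU i ] (f (proj₁ w) * g (proj₂ w)) ≈ ∑ (allFin (L i)) f * ∑ (allFin (M i)) g
  ∑-U-split f g = begin
    ∑[ w ∈ allU i ] (f (proj₁ w) * g (proj₂ w))              ≈⟨ ∑-cartesianProduct (allFin (L i)) (allFin (M i)) _ ⟩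
    ∑[ a ∈ allFin (L i) ] ∑[ b ∈ allFin (M i) ] (f a * g b)  ≈⟨ ∑-cong (allFin (L i)) (λ a → *-distribˡ-∑ (allFin (M i)) (f a) g) ⟨
    ∑[ a ∈ allFin (L i) ] (f a * ∑ (allFin (M i)) g)         ≈⟨ *-distribʳ-∑ (allFin (L i)) _ f ⟨
    ∑ (allFin (L i)) f * ∑ (allFin (M i)) g                  ∎

  ∑-s : ∀ gi → ∑ (allU i) (s gi) ≈ ν gi
  ∑-s gi = begin
    ∑ (allU i) (s gi)                                                   ≈⟨ ∑-cong (allU i) (λ w → s-split gi (proj₁ w) (proj₂ w)) ⟩
    ∑[ w ∈ allU i ] (blockᶜ gi (proj₁ w) * positionᶜ gi (proj₂ w))      ≈⟨ ∑-U-split (blockᶜ gi) (positionᶜ gi) ⟩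
    ∑ (allFin (L i)) (blockᶜ gi) * ∑ (allFin (M i)) (positionᶜ gi)      ≈⟨ *-congˡ (∑-positionᶜ gi) ⟩
    ∑ (allFin (L i)) (blockᶜ gi) * μ gi                                 ≈⟨ ∑-blockᶜ gi ⟩
    ν gi                                                                ∎

  blockᶜ-member : ∀ gi u → T (inR i gi (x i) u) → blockᶜ gi (proj₁ u) ≈ 1#
  blockᶜ-member i0 u u∈ = 𝟙-T (proj₁ (∧-split {eqF x₁ (proj₁ u)} u∈))
  blockᶜ-member i1 u u∈ = 𝟙-T (proj₁ (∧-split {eqF x₁ (proj₁ u)} u∈))
  blockᶜ-member i2 u u∈ = 𝟙-T u∈

  ∑-s-K : ∀ gi u → T (inR i gi (x i) u) → ∑[ w ∈ allU i ] (s gi w * K u w) ≈ μ gi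
  ∑-s-K gi u u∈ = begin
    ∑[ w ∈ allU i ] (s gi w * K u w)
      ≈⟨ ∑-cong (allU i) (λ w → trans (*-congʳ (s-split gi (proj₁ w) (proj₂ w))) (xy∙z≈xz∙y _ _ _)) ⟩
    ∑[ w ∈ allU i ] ((blockᶜ gi (proj₁ w) * 𝟙 (eqF (proj₁ u) (proj₁ w))) * positionᶜ gi (proj₂ w))
      ≈⟨ ∑-U-split (λ a → blockᶜ gi a * 𝟙 (eqF (proj₁ u) a)) (positionᶜ gi) ⟩
    ∑[ a ∈ allFin (L i) ] (blockᶜ gi a * 𝟙 (eqF (proj₁ u) a)) * ∑ (allFin (M i)) (positionᶜ gi)
      ≈⟨ *-cong (trans (∑-cong (allFin (L i)) (λ a → *-comm _ _)) (∑-δ (proj₁ u) (blockᶜ gi))) (∑-positionᶜ gi) ⟩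
    blockᶜ gi (proj₁ u) * μ gi
      ≈⟨ trans (*-congʳ (blockᶜ-member gi u u∈)) (*-identityˡ _) ⟩
    μ gi ∎

  K-sym : ∀ u v → K u v ≡ K v u
  K-sym u v = ≡.cong 𝟙 (eqF-sym (proj₁ u) (proj₁ v))

  K-trans : ∀ u w v → K u w * K w v ≈ K u w * K u v
  K-trans u w v with eqF (proj₁ u) (proj₁ w) in u~w
  ... | false = trans (zeroˡ _) (sym (zeroˡ _))
  ... | true rewrite eqF⇒≡ {a = proj₁ u} {proj₁ w} (≡.subst T (≡.sym u~w) tt) = refl

  ∑-linear : ∀ {a} {A : Set a} (xs : List A) (f p q : A → Carrier) α β γ →
    ∑[ w ∈ xs ] (f w * ((α * p w + β * q w) + γ))
      ≈ (α * ∑[ w ∈ xs ] (f w * p w) + β * ∑[ w ∈ xs ] (f w * q w)) + γ * ∑ xs f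
  ∑-linear xs f p q α β γ = begin
    ∑[ w ∈ xs ] (f w * ((α * p w + β * q w) + γ))
      ≈⟨ ∑-cong xs (λ w → solve 6 (λ f p q α β γ → f :* ((α :* p :+ β :* q) :+ γ)
                                       := (α :* (f :* p) :+ β :* (f :* q)) :+ γ :* f) refl (f w) (p w) (q w) α β γ) ⟩
    ∑[ w ∈ xs ] ((α * (f w * p w) + β * (f w * q w)) + γ * f w)
      ≈⟨ trans (∑-distrib-+ xs _ _) (+-congʳ (∑-distrib-+ xs _ _)) ⟩
    (∑[ w ∈ xs ] (α * (f w * p w)) + ∑[ w ∈ xs ] (β * (f w * q w))) + ∑[ w ∈ xs ] (γ * f w)
      ≈⟨ +-cong (+-cong (*-distribˡ-∑ xs α _) (*-distribˡ-∑ xs β _)) (*-distribˡ-∑ xs γ f) ⟨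
    (α * ∑[ w ∈ xs ] (f w * p w) + β * ∑[ w ∈ xs ] (f w * q w)) + γ * ∑ xs f ∎

  ⟪⟫-outˡ : ∀ gi t {u} v → inR i gi (x i) u ≡ false → ⟪ gi ∣ t ⟫ u v ≈ 0#
  ⟪⟫-outˡ gi (a , b , c) v u∉ = trans (*-congʳ (trans (*-congʳ (reflexive (≡.cong 𝟙 u∉))) (zeroˡ _))) (zeroˡ _)

  ⟪⟫-outʳ : ∀ gi t u {v} → inR i gi (x i) v ≡ false → ⟪ gi ∣ t ⟫ u v ≈ 0#
  ⟪⟫-outʳ gi (a , b , c) u v∉ = trans (*-congʳ (trans (*-congˡ (reflexive (≡.cong 𝟙 v∉))) (zeroʳ _))) (zeroˡ _)

  ∑-comb : ∀ gi t u → T (inR i gi (x i) u) →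
           ∑[ w ∈ allU i ] (s gi w * comb t u w) ≈ (proj₁ t * 1# + proj₁ (proj₂ t) * μ gi) + proj₂ (proj₂ t) * ν gi
  ∑-comb gi (a , b , c) u u∈ = begin
    ∑[ w ∈ allU i ] (s gi w * comb (a , b , c) u w)
      ≈⟨ ∑-linear (allU i) (s gi) (I u) (K u) a b c ⟩
    (a * ∑[ w ∈ allU i ] (s gi w * I u w) + b * ∑[ w ∈ allU i ] (s gi w * K u w)) + c * ∑ (allU i) (s gi)
      ≈⟨ +-cong (+-cong (*-congˡ diagonal) (*-congˡ (∑-s-K gi u u∈))) (*-congˡ (∑-s gi)) ⟩
    (a * 1# + b * μ gi) + c * ν gi ∎
    where
    diagonal : ∑[ w ∈ allU i ] (s gi w * I u w) ≈ 1#
    diagonal = trans (∑-cong (allU i) (λ w → *-comm _ _)) (trans (∑-U-δ i u (s gi)) (𝟙-T u∈))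

  ∑-comb-K : ∀ gi t u v → T (inR i gi (x i) u) → T (inR i gi (x i) v) →
             ∑[ w ∈ allU i ] ((s gi w * comb t u w) * K w v)
               ≈ (proj₁ t * K u v + proj₁ (proj₂ t) * (μ gi * K u v)) + proj₂ (proj₂ t) * μ gi
  ∑-comb-K gi (a , b , c) u v u∈ v∈ = begin
    ∑[ w ∈ allU i ] ((s gi w * comb (a , b , c) u w) * K w v)
      ≈⟨ ∑-cong (allU i) (λ w → xy∙z≈xz∙y _ _ _) ⟩
    ∑[ w ∈ allU i ] ((s gi w * K w v) * comb (a , b , c) u w)
      ≈⟨ ∑-linear (allU i) (λ w → s gi w * K w v) (I u) (K u) a b c ⟩
    (a * ∑[ w ∈ allU i ] ((s gi w * K w v) * I u w) + b * ∑[ w ∈ allU i ] ((s gi w * K w v) * K u w))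
      + c * ∑[ w ∈ allU i ] (s gi w * K w v)
      ≈⟨ +-cong (+-cong (*-congˡ via-I) (*-congˡ via-K)) (*-congˡ count) ⟩
    (a * K u v + b * (μ gi * K u v)) + c * μ gi ∎
    where
    via-I : ∑[ w ∈ allU i ] ((s gi w * K w v) * I u w) ≈ K u v
    via-I = trans (∑-cong (allU i) (λ w → *-comm _ _))
                  (trans (∑-U-δ i u (λ w → s gi w * K w v)) (trans (*-congʳ (𝟙-T u∈)) (*-identityˡ _)))
    via-K : ∑[ w ∈ allU i ] ((s gi w * K w v) * K u w) ≈ μ gi * K u v
    via-K = begin
      ∑[ w ∈ allU i ] ((s gi w * K w v) * K u w)  ≈⟨ ∑-cong (allU i) (λ w → trans (xy∙z≈x∙zy _ _ _) (*-congˡ (K-trans u w v))) ⟩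
      ∑[ w ∈ allU i ] (s gi w * (K u w * K u v))  ≈⟨ ∑-cong (allU i) (λ w → sym (*-assoc _ _ _)) ⟩
      ∑[ w ∈ allU i ] ((s gi w * K u w) * K u v)  ≈⟨ *-distribʳ-∑ (allU i) (K u v) _ ⟨
      ∑[ w ∈ allU i ] (s gi w * K u w) * K u v    ≈⟨ *-congʳ (∑-s-K gi u u∈) ⟩
      μ gi * K u v                                ∎
    count : ∑[ w ∈ allU i ] (s gi w * K w v) ≈ μ gi
    count = trans (∑-cong (allU i) (λ w → *-congˡ (reflexive (K-sym w v)))) (∑-s-K gi v v∈)

  ⟪⟫-· : ∀ gi t t′ u v → ∑[ w ∈ allU i ] (⟪ gi ∣ t ⟫ u w * ⟪ gi ∣ t′ ⟫ w v) ≈ ⟪ gi ∣ t ⊗⟨ μ gi , ν gi ⟩ t′ ⟫ u v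
  ⟪⟫-· gi t@(a , b , c) t′@(a′ , b′ , c′) u v = cases (inR i gi (x i) u) ≡.refl (inR i gi (x i) v) ≡.refl
    where
    both-inside : T (inR i gi (x i) u) → T (inR i gi (x i) v) →
                  ∑[ w ∈ allU i ] (⟪ gi ∣ t ⟫ u w * ⟪ gi ∣ t′ ⟫ w v) ≈ ⟪ gi ∣ t ⊗⟨ μ gi , ν gi ⟩ t′ ⟫ u v
    both-inside u∈ v∈ = begin
      ∑[ w ∈ allU i ] (((s gi u * s gi w) * comb t u w) * ((s gi w * s gi v) * comb t′ w v))
        ≈⟨ ∑-cong (allU i) drop-support ⟩
      ∑[ w ∈ allU i ] ((s gi w * comb t u w) * comb t′ w v)
        ≈⟨ ∑-linear (allU i) (λ w → s gi w * comb t u w) (λ w → I w v) (λ w → K w v) a′ b′ c′ ⟩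
      (a′ * ∑[ w ∈ allU i ] ((s gi w * comb t u w) * I w v) + b′ * ∑[ w ∈ allU i ] ((s gi w * comb t u w) * K w v))
        + c′ * ∑[ w ∈ allU i ] (s gi w * comb t u w)
        ≈⟨ +-cong (+-cong (*-congˡ diagonal) (*-congˡ (∑-comb-K gi t u v u∈ v∈))) (*-congˡ (∑-comb gi t u u∈)) ⟩
      (a′ * comb t u v + b′ * ((a * K u v + b * (μ gi * K u v)) + c * μ gi)) + c′ * ((a * 1# + b * μ gi) + c * ν gi)
        ≈⟨ solve 12 (λ a b c a′ b′ c′ I K μ ν su sv →
              (a′ :* ((a :* I :+ b :* K) :+ c) :+ b′ :* ((a :* K :+ b :* (μ :* K)) :+ c :* μ)) :+ c′ :* ((a :* :1 :+ b :* μ) :+ c :* ν)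
              := (:1 :* :1) :* (((a :* a′) :* I :+ ((a :* b′ :+ b :* a′) :+ μ :* (b :* b′)) :* K)
                                :+ (((a :* c′ :+ c :* a′) :+ μ :* (b :* c′ :+ c :* b′)) :+ ν :* (c :* c′))))
            refl a b c a′ b′ c′ (I u v) (K u v) (μ gi) (ν gi) 1# 1# ⟩
      (1# * 1#) * comb (t ⊗⟨ μ gi , ν gi ⟩ t′) u v
        ≈⟨ *-congʳ (*-cong (𝟙-T u∈) (𝟙-T v∈)) ⟨
      ⟪ gi ∣ t ⊗⟨ μ gi , ν gi ⟩ t′ ⟫ u v ∎
      where
      drop-support : ∀ w → ((s gi u * s gi w) * comb t u w) * ((s gi w * s gi v) * comb t′ w v)
                           ≈ (s gi w * comb t u w) * comb t′ w v
      drop-support w = begin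
        ((s gi u * s gi w) * comb t u w) * ((s gi w * s gi v) * comb t′ w v)
          ≈⟨ *-cong (*-congʳ (*-congʳ (𝟙-T u∈))) (*-congʳ (*-congˡ (𝟙-T v∈))) ⟩
        ((1# * s gi w) * comb t u w) * ((s gi w * 1#) * comb t′ w v)
          ≈⟨ solve 3 (λ S X Y → ((:1 :* S) :* X) :* ((S :* :1) :* Y) := (S :* S) :* (X :* Y)) refl (s gi w) (comb t u w) (comb t′ w v) ⟩
        (s gi w * s gi w) * (comb t u w * comb t′ w v)
          ≈⟨ trans (*-congʳ (𝟙-idem (inR i gi (x i) w))) (sym (*-assoc _ _ _)) ⟩
        (s gi w * comb t u w) * comb t′ w v ∎
      diagonal : ∑[ w ∈ allU i ] ((s gi w * comb t u w) * I w v) ≈ comb t u v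
      diagonal = trans (∑-U-δ′ i v (λ w → s gi w * comb t u w)) (trans (*-congʳ (𝟙-T v∈)) (*-identityˡ _))

    cases : ∀ bu → inR i gi (x i) u ≡ bu → ∀ bv → inR i gi (x i) v ≡ bv →
            ∑[ w ∈ allU i ] (⟪ gi ∣ t ⟫ u w * ⟪ gi ∣ t′ ⟫ w v) ≈ ⟪ gi ∣ t ⊗⟨ μ gi , ν gi ⟩ t′ ⟫ u v
    cases false u∉ _ _ =
      trans (∑-zero (allU i) (λ w → trans (*-congʳ (⟪⟫-outˡ gi t w u∉)) (zeroˡ _))) (sym (⟪⟫-outˡ gi _ v u∉))
    cases true _ false v∉ =
      trans (∑-zero (allU i) (λ w → trans (*-congˡ (⟪⟫-outʳ gi t′ w v∉)) (zeroʳ _))) (sym (⟪⟫-outʳ gi _ u v∉))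
    cases true u∈ true v∈ = both-inside (≡.subst T (≡.sym u∈) tt) (≡.subst T (≡.sym v∈) tt)

  ⟪⟫-cong : ∀ gi {t t′} u v → t ≈₃ t′ → ⟪ gi ∣ t ⟫ u v ≈ ⟪ gi ∣ t′ ⟫ u v
  ⟪⟫-cong gi {_ , _ , _} {_ , _ , _} u v (p , q , r) = *-congˡ (+-cong (+-cong (*-congʳ p) (*-congʳ q)) r)

  ⟪⟫-scale : ∀ gi r t u v → r * ⟪ gi ∣ t ⟫ u v ≈ ⟪ gi ∣ r ·₃ t ⟫ u v
  ⟪⟫-scale gi r (a , b , c) u v =
    solve 7 (λ r S a b c I K → r :* (S :* ((a :* I :+ b :* K) :+ c)) := S :* (((r :* a) :* I :+ (r :* b) :* K) :+ r :* c))
          refl r (s gi u * s gi v) a b c (I u v) (K u v)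

  ⟪⟫-sub : ∀ gi t t′ u v → ⟪ gi ∣ t ⟫ u v - ⟪ gi ∣ t′ ⟫ u v ≈ ⟪ gi ∣ t -₃ t′ ⟫ u v
  ⟪⟫-sub gi (a , b , c) (a′ , b′ , c′) u v =
    solve 9 (λ S a b c a′ b′ c′ I K → S :* ((a :* I :+ b :* K) :+ c) :- S :* ((a′ :* I :+ b′ :* K) :+ c′)
                                     := S :* (((a :- a′) :* I :+ (b :- b′) :* K) :+ (c :- c′)))
          refl (s gi u * s gi v) a b c a′ b′ c′ (I u v) (K u v)

  -- Coefficients of ∑ⱼ φ j R_j restricted to R_gi(x i); bM (bL) tells whether a
  -- block has more than two points (there are more than two blocks).
  restrict : Bool → Bool → Idx → (Idx → Carrier) → Coeffs
  restrict _     _     i0 φ = φ i0 , 0# , 0#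
  restrict true  _     i1 φ = φ i0 - φ i1 , 0# , φ i1
  restrict false _     i1 φ = φ i0 , 0# , 0#
  restrict _     true  i2 φ = φ i0 - φ i1 , φ i1 - φ i2 , φ i2
  restrict _     false i2 φ = φ i0 - φ i1 , 0# , φ i1

  private
    -- ∑ⱼ φ j R_j and a I + b K + c J at a pair (u , v), through e₁ = [u, v in the
    -- same block] and e₂ = [u, v in the same position].
    Rsum : Bool → Bool → (Idx → Carrier) → Carrier
    Rsum e₁ e₂ φ = φ i0 * 𝟙 (e₁ ∧ e₂) + (φ i1 * 𝟙 (e₁ ∧ not e₂) + (φ i2 * 𝟙 (not e₁) + 0#))

    IKJsum : Bool → Bool → Coeffs → Carrier
    IKJsum e₁ e₂ (a , b , c) = (a * 𝟙 (e₁ ∧ e₂) + b * 𝟙 e₁) + c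

    same-point : ∀ φ → Rsum true true φ ≈ IKJsum true true (φ i0 , 0# , 0#)
    same-point φ = solve 3 (λ a b c → a :* :1 :+ (b :* :0 :+ (c :* :0 :+ :0)) := (a :* :1 :+ :0 :* :1) :+ :0) refl (φ i0) (φ i1) (φ i2)

    same-block : ∀ e₂ φ → Rsum true e₂ φ ≈ IKJsum true e₂ (φ i0 - φ i1 , 0# , φ i1)
    same-block true  φ = solve 3 (λ a b c → a :* :1 :+ (b :* :0 :+ (c :* :0 :+ :0)) := ((a :- b) :* :1 :+ :0 :* :1) :+ b) refl (φ i0) (φ i1) (φ i2)
    same-block false φ = solve 3 (λ a b c → a :* :0 :+ (b :* :1 :+ (c :* :0 :+ :0)) := ((a :- b) :* :0 :+ :0 :* :1) :+ b) refl (φ i0) (φ i1) (φ i2)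

    any-pair : ∀ e₁ e₂ φ → Rsum e₁ e₂ φ ≈ IKJsum e₁ e₂ (φ i0 - φ i1 , φ i1 - φ i2 , φ i2)
    any-pair true  true  φ = solve 3 (λ a b c → a :* :1 :+ (b :* :0 :+ (c :* :0 :+ :0)) := ((a :- b) :* :1 :+ (b :- c) :* :1) :+ c) refl (φ i0) (φ i1) (φ i2)
    any-pair true  false φ = solve 3 (λ a b c → a :* :0 :+ (b :* :1 :+ (c :* :0 :+ :0)) := ((a :- b) :* :0 :+ (b :- c) :* :1) :+ c) refl (φ i0) (φ i1) (φ i2)
    any-pair false e₂    φ = solve 3 (λ a b c → a :* :0 :+ (b :* :0 :+ (c :* :1 :+ :0)) := ((a :- b) :* :0 :+ (b :- c) :* :0) :+ c) refl (φ i0) (φ i1) (φ i2)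

  Rsum≈restrict : ∀ bM bL → 2 ≤ L i → 2 ≤ M i → bM ≡ (2 <ᵇ M i) → bL ≡ (2 <ᵇ L i) →
    ∀ gi φ u v → T (inR i gi (x i) u) → T (inR i gi (x i) v) →
    Rsum (eqF (proj₁ u) (proj₁ v)) (eqF (proj₂ u) (proj₂ v)) φ
      ≈ IKJsum (eqF (proj₁ u) (proj₁ v)) (eqF (proj₂ u) (proj₂ v)) (restrict bM bL gi φ)
  Rsum≈restrict bM bL _ _ _ _ i0 φ (u₁ , u₂) (v₁ , v₂) u∈ v∈
    rewrite eqF-via {c = x₁} (proj₁ (∧-split u∈)) (proj₁ (∧-split v∈))
          | eqF-via {c = x₂} (proj₂ (∧-split {eqF x₁ u₁} u∈)) (proj₂ (∧-split {eqF x₁ v₁} v∈)) = same-point φ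
  Rsum≈restrict true bL _ _ _ _ i1 φ (u₁ , u₂) (v₁ , v₂) u∈ v∈
    rewrite eqF-via {c = x₁} (proj₁ (∧-split u∈)) (proj₁ (∧-split v∈)) = same-block (eqF u₂ v₂) φ
  Rsum≈restrict false bL _ 2≤M eM _ i1 φ (u₁ , u₂) (v₁ , v₂) u∈ v∈
    rewrite eqF-via {c = x₁} (proj₁ (∧-split u∈)) (proj₁ (∧-split v∈))
          | eqF-Fin2 (≮ᵇ⇒≡2 2≤M (≡.sym eM)) x₂ u₂ v₂ (proj₂ (∧-split {eqF x₁ u₁} u∈)) (proj₂ (∧-split {eqF x₁ v₁} v∈)) = same-point φ
  Rsum≈restrict bM true _ _ _ _ i2 φ (u₁ , u₂) (v₁ , v₂) u∈ v∈ = any-pair (eqF u₁ v₁) (eqF u₂ v₂) φ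
  Rsum≈restrict bM false 2≤L _ _ eL i2 φ (u₁ , u₂) (v₁ , v₂) u∈ v∈
    rewrite eqF-Fin2 (≮ᵇ⇒≡2 2≤L (≡.sym eL)) x₁ u₁ v₁ u∈ v∈ = same-block (eqF u₂ v₂) φ

  ∑-ρ-restrict : ∀ bM bL → 2 ≤ L i → 2 ≤ M i → bM ≡ (2 <ᵇ M i) → bL ≡ (2 <ᵇ L i) → ∀ gi φ u v →
        ∑[ j ∈ allIdx ] (φ j * ρ x gi j gi i u v) ≈ ⟪ gi ∣ restrict bM bL gi φ ⟫ u v
  ∑-ρ-restrict bM bL 2≤L 2≤M eM eL gi φ u v = begin
    ∑[ j ∈ allIdx ] (φ j * ρ x gi j gi i u v)
      ≈⟨ solve 8 (λ su sv a b c r₀ r₁ r₂ →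
                    a :* ((su :* r₀) :* sv) :+ (b :* ((su :* r₁) :* sv) :+ (c :* ((su :* r₂) :* sv) :+ :0))
                    := (su :* sv) :* (a :* r₀ :+ (b :* r₁ :+ (c :* r₂ :+ :0))))
               refl (s gi u) (s gi v) (φ i0) (φ i1) (φ i2) (𝟙 (inR i i0 u v)) (𝟙 (inR i i1 u v)) (𝟙 (inR i i2 u v)) ⟩
    (s gi u * s gi v) * Rsum (eqF (proj₁ u) (proj₁ v)) (eqF (proj₂ u) (proj₂ v)) φ
      ≈⟨ 𝟙-guard₂ (inR i gi (x i) u) (inR i gi (x i) v) (Rsum≈restrict bM bL 2≤L 2≤M eM eL gi φ u v) ⟩
    ⟪ gi ∣ restrict bM bL gi φ ⟫ u v ∎

module LocalIdempotents {c ℓ : Level} (F : Field c ℓ) (p : ℕ) (hc : HasChar F p)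
                        (n : ℕ) (L M : Fin n → ℕ) (x : Setup.X F n L M)
                        (i : Fin n) (2≤L : 2 ≤ L i) (2≤M : 2 ≤ M i) where
  open FieldProperties F
  open BigOperators commutativeSemiring
  open Characteristic F p hc
  open Setup F n L M
  open Factorisation F n L M
  open D-Factorisation F p hc n L M x
  open IKJ F
  open Subconstituent F n L M x i

  hₘ₋₁ hₘ hₗₘ : Carrier
  hₘ₋₁ = recip (kᶠ i (true , false , false))
  hₘ   = recip (kᶠ i (false , false , true))
  hₗₘ  = recip (kᶠ i (false , true , true))

  -- The normalised k_α⁻¹ B_α along the local interval, from the largest
  -- subconstituent matrix down to the smallest.
  chain : Idx → Bool → Bool → ℕ → Coeffs
  chain _  _    _     zero             = I₃
  chain i1 true _     (suc zero)       = hₘ₋₁ ·₃ J₃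
  chain i2 _    false (suc zero)       = hₘ ·₃ J₃
  chain i2 _    true  (suc zero)       = hₘ ·₃ K₃
  chain i2 _    true  (suc (suc zero)) = hₗₘ ·₃ J₃
  chain _  _    _     _                = 0₃

  kᶠ-tff : kᶠ i (true , false , false) ≡ M i ∸ 1
  kᶠ-tff = ≡.trans (ℕ.*-identityʳ _) (ℕ.*-identityʳ _)

  kᶠ-fft : kᶠ i (false , false , true) ≡ M i
  kᶠ-fft = ℕ.*-identityˡ (M i)

  kᶠ-ftt : kᶠ i (false , true , true) ≡ (L i ∸ 1) ℕ.* M i
  kᶠ-ftt = ≡.trans (ℕ.*-identityʳ _) (ℕ.*-identityˡ _)

  ι*recip²′ : ∀ {k m} → k ≡ m → ι F m * (recip k * recip k) ≈ recip k
  ι*recip²′ ≡.refl = ι*recip² _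

  ν-i2-ℓ≡2 : (2 <ᵇ L i) ≡ false → ν i2 ≈ ι F (M i)
  ν-i2-ℓ≡2 eL rewrite ≮ᵇ⇒≡2 2≤L eL = trans (*-congʳ (+-identityʳ 1#)) (*-identityˡ _)

  ν-i2 : ν i2 ≈ ι F ((L i ∸ 1) ℕ.* M i)
  ν-i2 = sym (ι-homo-* (L i ∸ 1) (M i))

  ι*hₘ*hₗₘ≈hₗₘ : ι F (M i) * (hₘ * hₗₘ) ≈ hₗₘ
  ι*hₘ*hₗₘ≈hₗₘ rewrite kᶠ-fft | kᶠ-ftt = ι*recip-absorb (M i) (L i ∸ 1)

  chain-⊗ : ∀ gi bM bL → bL ≡ (2 <ᵇ L i) → ∀ a b →
            chain gi bM bL a ⊗⟨ μ gi , ν gi ⟩ chain gi bM bL b ≈₃ chain gi bM bL (a ⊔ b)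
  chain-⊗ gi bM bL _ zero b = ⊗-identityˡ _ _ _
  chain-⊗ gi bM bL _ (suc a) zero = ⊗-identityʳ _ _ _
  chain-⊗ i0 bM bL _ (suc a) (suc b) = ⊗-zeroˡ _ _ _
  chain-⊗ i1 false bL _ (suc a) (suc b) = ⊗-zeroˡ _ _ _
  chain-⊗ i1 true bL _ 1 1 = ≈₃-trans (J⊗J _ _ hₘ₋₁ hₘ₋₁) (·₃-congʳ J₃ (ι*recip²′ kᶠ-tff))
  chain-⊗ i1 true bL _ 1 (suc (suc b)) = ⊗-zeroʳ _ _ _
  chain-⊗ i1 true bL _ (suc (suc a)) 1 = ⊗-zeroˡ _ _ _
  chain-⊗ i1 true bL _ (suc (suc a)) (suc (suc b)) = ⊗-zeroˡ _ _ _
  chain-⊗ i2 bM false eL 1 1 = ≈₃-trans (J⊗J _ _ hₘ hₘ) (·₃-congʳ J₃ (trans (*-congʳ (ν-i2-ℓ≡2 (≡.sym eL))) (ι*recip²′ kᶠ-fft)))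
  chain-⊗ i2 bM false _ 1 (suc (suc b)) = ⊗-zeroʳ _ _ _
  chain-⊗ i2 bM false _ (suc (suc a)) 1 = ⊗-zeroˡ _ _ _
  chain-⊗ i2 bM false _ (suc (suc a)) (suc (suc b)) = ⊗-zeroˡ _ _ _
  chain-⊗ i2 bM true _ 1 1 = ≈₃-trans (K⊗K _ _ hₘ hₘ) (·₃-congʳ K₃ (ι*recip²′ kᶠ-fft))
  chain-⊗ i2 bM true _ 1 2 = ≈₃-trans (K⊗J _ _ hₘ hₗₘ) (·₃-congʳ J₃ ι*hₘ*hₗₘ≈hₗₘ)
  chain-⊗ i2 bM true _ 2 1 = ≈₃-trans (J⊗K _ _ hₗₘ hₘ) (·₃-congʳ J₃ (trans (*-congˡ (*-comm hₗₘ hₘ)) ι*hₘ*hₗₘ≈hₗₘ))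
  chain-⊗ i2 bM true _ 2 2 = ≈₃-trans (J⊗J _ _ hₗₘ hₗₘ) (·₃-congʳ J₃ (trans (*-congʳ ν-i2) (ι*recip²′ kᶠ-ftt)))
  chain-⊗ i2 bM true _ 1 (suc (suc (suc b))) = ⊗-zeroʳ _ _ _
  chain-⊗ i2 bM true _ 2 (suc (suc (suc b))) = ⊗-zeroʳ _ _ _
  chain-⊗ i2 bM true _ (suc (suc (suc a))) 1 = ⊗-zeroˡ _ _ _
  chain-⊗ i2 bM true _ (suc (suc (suc a))) 2 = ⊗-zeroˡ _ _ _
  chain-⊗ i2 bM true _ (suc (suc (suc a))) (suc (suc (suc b))) = ⊗-zeroˡ _ _ _

  private
    normalise : ∀ gi bM bL β → bM ≡ (2 <ᵇ M i) → bL ≡ (2 <ᵇ L i) → ∀ {e} →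
                recip (kᶠ i β) ·₃ restrict bM bL gi (λ j → 𝟙 (admissible gi gi bM bL β j)) ≈₃ e →
                ∀ u v → recip (kᶠ i β) * Bᶠ x gi gi bM bL β i u v ≈ ⟪ gi ∣ e ⟫ u v
    normalise gi bM bL β eM eL coeffs u v =
      trans (*-congˡ (∑-ρ-restrict bM bL 2≤L 2≤M eM eL gi _ u v)) (trans (⟪⟫-scale gi _ _ u v) (⟪⟫-cong gi u v coeffs))

    1-0≈1 : 1# - 0# ≈ 1#
    1-0≈1 = trans (+-congˡ -0#≈0#) (+-identityʳ 1#)

    x-x≈0 : ∀ {x} → x - x ≈ 0#
    x-x≈0 = -‿inverseʳ _

    unit : ∀ {a b c} → a ≈ 1# → b ≈ 0# → c ≈ 0# → recip 1 ·₃ (a , b , c) ≈₃ I₃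
    unit a≈1 b≈0 c≈0 = trans (*-cong recip-1 a≈1) (*-identityˡ 1#) , trans (*-congˡ b≈0) (zeroʳ _) , trans (*-congˡ c≈0) (zeroʳ _)

    onK : ∀ r {a b c} → a ≈ 0# → b ≈ 1# → c ≈ 0# → r ·₃ (a , b , c) ≈₃ r ·₃ K₃
    onK r a≈0 b≈1 c≈0 = *-congˡ a≈0 , *-congˡ b≈1 , *-congˡ c≈0

    onJ : ∀ r {a b c} → a ≈ 0# → b ≈ 0# → c ≈ 1# → r ·₃ (a , b , c) ≈₃ r ·₃ J₃
    onJ r a≈0 b≈0 c≈1 = *-congˡ a≈0 , *-congˡ b≈0 , *-congˡ c≈1

    one-term : ∀ gi r B t u v → r * B ≈ ⟪ gi ∣ t ⟫ u v → (1# * r) * B + 0# ≈ ⟪ gi ∣ t -₃ 0₃ ⟫ u v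
    one-term gi r B t u v rB≈ = begin
      (1# * r) * B + 0#                                    ≈⟨ solve 5 (λ r B S I K → (:1 :* r) :* B :+ :0 := r :* B :- S :* ((:0 :* I :+ :0 :* K) :+ :0))
                                                                  refl r B (s gi u * s gi v) (I u v) (K u v) ⟩
      r * B - ⟪ gi ∣ 0₃ ⟫ u v                              ≈⟨ +-congʳ rB≈ ⟩
      ⟪ gi ∣ t ⟫ u v - ⟪ gi ∣ 0₃ ⟫ u v                     ≈⟨ ⟪⟫-sub gi t 0₃ u v ⟩
      ⟪ gi ∣ t -₃ 0₃ ⟫ u v                                 ∎

    two-terms : ∀ gi r B t r′ B′ t′ u v → r * B ≈ ⟪ gi ∣ t ⟫ u v → r′ * B′ ≈ ⟪ gi ∣ t′ ⟫ u v →
                ((- 1# * 1#) * r′) * B′ + ((1# * r) * B + 0#) ≈ ⟪ gi ∣ t -₃ t′ ⟫ u v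
    two-terms gi r B t r′ B′ t′ u v rB≈ r′B′≈ = begin
      ((- 1# * 1#) * r′) * B′ + ((1# * r) * B + 0#)  ≈⟨ solve 4 (λ r B r′ B′ → ((:- :1 :* :1) :* r′) :* B′ :+ ((:1 :* r) :* B :+ :0) := r :* B :- r′ :* B′)
                                                            refl r B r′ B′ ⟩
      r * B - r′ * B′                                ≈⟨ +-cong rB≈ (-‿cong r′B′≈) ⟩
      ⟪ gi ∣ t ⟫ u v - ⟪ gi ∣ t′ ⟫ u v               ≈⟨ ⟪⟫-sub gi t t′ u v ⟩
      ⟪ gi ∣ t -₃ t′ ⟫ u v                           ∎

  Dᶠ-chain : ∀ {gi bM bL τᵢ} → Valid gi bM bL τᵢ → bM ≡ (2 <ᵇ M i) → bL ≡ (2 <ᵇ L i) → ∀ u v →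
             Dᶠ bM bL gi τᵢ i u v ≈ ⟪ gi ∣ Δ (chain gi bM bL) ∣ τᵢ ∣ᵇ ⟫ u v
  Dᶠ-chain {bM = bM} {bL} point eM eL u v =
    one-term i0 _ _ _ u v (normalise i0 bM bL (false , false , false) eM eL (unit refl refl refl) u v)
  Dᶠ-chain {bM = true} {bL} block₀ eM eL u v =
    two-terms i1 _ _ _ _ _ _ u v (normalise i1 true bL (false , false , false) eM eL (unit 1-0≈1 refl refl) u v)
                                 (normalise i1 true bL (true , false , false) eM eL (onJ hₘ₋₁ x-x≈0 refl refl) u v)
  Dᶠ-chain {bM = false} {bL} block₀ eM eL u v =
    one-term i1 _ _ _ u v (normalise i1 false bL (false , false , false) eM eL (unit refl refl refl) u v)
  Dᶠ-chain {bL = bL} block₁ eM eL u v =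
    one-term i1 _ _ _ u v (normalise i1 true bL (true , false , false) eM eL (onJ hₘ₋₁ x-x≈0 refl refl) u v)
  Dᶠ-chain {bM = bM} {true} far₀ eM eL u v =
    two-terms i2 _ _ _ _ _ _ u v (normalise i2 bM true (false , false , false) eM eL (unit 1-0≈1 x-x≈0 refl) u v)
                                 (normalise i2 bM true (false , false , true) eM eL (onK hₘ x-x≈0 1-0≈1 refl) u v)
  Dᶠ-chain {bM = bM} {false} far₀ eM eL u v =
    two-terms i2 _ _ _ _ _ _ u v (normalise i2 bM false (false , false , false) eM eL (unit 1-0≈1 refl refl) u v)
                                 (normalise i2 bM false (false , false , true) eM eL (onJ hₘ x-x≈0 refl refl) u v)
  Dᶠ-chain {bM = bM} {true} far₁ eM eL u v =
    two-terms i2 _ _ _ _ _ _ u v (normalise i2 bM true (false , false , true) eM eL (onK hₘ x-x≈0 1-0≈1 refl) u v)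
                                 (normalise i2 bM true (false , true , true) eM eL (onJ hₗₘ x-x≈0 x-x≈0 refl) u v)
  Dᶠ-chain {bM = bM} {false} far₁ eM eL u v =
    one-term i2 _ _ _ u v (normalise i2 bM false (false , false , true) eM eL (onJ hₘ x-x≈0 refl refl) u v)
  Dᶠ-chain {bM = bM} far₂ eM eL u v =
    one-term i2 _ _ _ u v (normalise i2 bM true (false , true , true) eM eL (onJ hₗₘ x-x≈0 x-x≈0 refl) u v)

  Dᶠ-orthogonal : ∀ {gi bM bL τᵢ σᵢ} → Valid gi bM bL τᵢ → Valid gi bM bL σᵢ →
                  bM ≡ (2 <ᵇ M i) → bL ≡ (2 <ᵇ L i) → ∀ u v →
                  ∑[ w ∈ allU i ] (Dᶠ bM bL gi τᵢ i u w * Dᶠ bM bL gi σᵢ i w v) ≈ 𝟙 (τᵢ =ᵇ σᵢ) * Dᶠ bM bL gi τᵢ i u v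
  Dᶠ-orthogonal {gi} {bM} {bL} {τᵢ} {σᵢ} vτ vσ eM eL u v = begin
    ∑[ w ∈ allU i ] (Dᶠ bM bL gi τᵢ i u w * Dᶠ bM bL gi σᵢ i w v)
      ≈⟨ ∑-cong (allU i) (λ w → *-cong (Dᶠ-chain vτ eM eL u w) (Dᶠ-chain vσ eM eL w v)) ⟩
    ∑[ w ∈ allU i ] (⟪ gi ∣ Δ P r ⟫ u w * ⟪ gi ∣ Δ P r′ ⟫ w v)
      ≈⟨ ⟪⟫-· gi (Δ P r) (Δ P r′) u v ⟩
    ⟪ gi ∣ Δ P r ⊗⟨ μ gi , ν gi ⟩ Δ P r′ ⟫ u v
      ≈⟨ ⟪⟫-cong gi u v (chain-orthogonal (μ gi) (ν gi) P (chain-⊗ gi bM bL eL) r r′) ⟩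
    ⟪ gi ∣ 𝟙 (r ≡ᵇ r′) ·₃ Δ P r ⟫ u v
      ≈⟨ ⟪⟫-scale gi _ (Δ P r) u v ⟨
    𝟙 (r ≡ᵇ r′) * ⟪ gi ∣ Δ P r ⟫ u v
      ≈⟨ *-cong (reflexive (≡.cong 𝟙 (≡.sym (size-injective vτ vσ)))) (Dᶠ-chain vτ eM eL u v) ⟨
    𝟙 (τᵢ =ᵇ σᵢ) * Dᶠ bM bL gi τᵢ i u v ∎
    where
    P : ℕ → Coeffs
    P = chain gi bM bL
    r r′ : ℕ
    r  = ∣ τᵢ ∣ᵇ
    r′ = ∣ σᵢ ∣ᵇ

module Orthogonality {c ℓ : Level} (F : Field c ℓ) (p : ℕ) (hc : HasChar F p) (n : ℕ) (L M : Fin n → ℕ)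
                     (2≤L : ∀ i → 2 ≤ L i) (2≤M : ∀ i → 2 ≤ M i) (x : Setup.X F n L M) where
  open FieldProperties F
  open BigOperators commutativeSemiring
  open Setup F n L M
  open AtVertex x
  open Factorisation F n L M
  open D-Factorisation F p hc n L M x

  D-orthogonal : ∀ g τ σ → InU g g τ → InU g g σ → (D p g τ ·ᴹ D p g σ) ≈ᴹ (δ τ σ ∙ᴹ D p g τ)
  D-orthogonal g τ σ τ∈ σ∈ y z = begin
    (D p g τ ·ᴹ D p g σ) y z
      ≈⟨ ·ᴹ-⊗ {f = Dᵢ g τ} {g = Dᵢ g σ} (D-⊗ g τ) (D-⊗ g σ) y z ⟩
    ∏ (λ i → ∑[ w ∈ allU i ] (Dᵢ g τ i (y i) w * Dᵢ g σ i w (z i)))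
      ≈⟨ ∏-cong (λ i → LocalIdempotents.Dᶠ-orthogonal F p hc n L M x i (2≤L i) (2≤M i)
                         (InU⇒Valid g τ τ∈ i) (InU⇒Valid g σ σ∈ i) ≡.refl ≡.refl (y i) (z i)) ⟩
    ∏ (λ i → 𝟙 ((τ at i) =ᵇ (σ at i)) * Dᵢ g τ i (y i) (z i))
      ≈⟨ ∏-distrib-* (λ i → 𝟙 ((τ at i) =ᵇ (σ at i))) (λ i → Dᵢ g τ i (y i) (z i)) ⟩
    ∏ (λ i → 𝟙 ((τ at i) =ᵇ (σ at i))) * ∏ (λ i → Dᵢ g τ i (y i) (z i))
      ≈⟨ *-cong (δ-⊗ τ σ) (D-⊗ g τ y z) ⟨
    δ τ σ * D p g τ y z ∎
    where
    Dᵢ : E → Triple n → (i : Fin n) → U i → U i → Carrier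
    Dᵢ g τ i = Dᶠ (2 <ᵇ M i) (2 <ᵇ L i) (g i) (τ at i) i

open import Data.Nat using (_*_)

lemma5p16 : ∀ {c ℓ : Level} (F : Field c ℓ) (p : ℕ) → HasChar F p →
    (n : ℕ) → 1 ≤ n → (L M : Fin n → ℕ) → (∀ i → 2 ≤ L i) → (∀ i → 2 ≤ M i) →
    let open Setup F n L M in
    (x : X) → let open AtVertex x in
    (g : E) (τ σ : Triple n) → InU g g τ → InU g g σ → ¬ (p ∣ (k τ * k σ)) →
    (D p g τ ·ᴹ D p g σ) ≈ᴹ (δ τ σ ∙ᴹ D p g τ)
lemma5p16 F p hc n _ L M 2≤L 2≤M x g τ σ τ∈ σ∈ _ =
  Orthogonality.D-orthogonal F p hc n L M 2≤L 2≤M x g τ σ τ∈ σ∈
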